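{- Let $T$ be a tree on $n\ge 4$ vertices. Then $\Omega(T)=\frac{\mathrm{Var}(T)}{S(T)}\ge\frac1{2n}$, with equality if and only if $T$ is isomorphic to the path $P_n$.
   Context: For a graph with $n$ vertices, $m$ edges and degrees $d_1,\dots,d_n$: $S(G)=\sum_i|d_i-\frac{2m}{n}|$, $\mathrm{Var}(G)=\frac1n\sum_i(d_i-\frac{2m}{n})^2$, $\Omega(G)=\mathrm{Var}(G)/S(G)$. -}

module Defs where

open import Data.Nat as ℕ using (ℕ; zero; suc; _≟_)
open import Data.Integer as ℤ using (+_)
open import Data.Rational as ℚ using (ℚ; 0ℚ; _/_; _÷_; ∣_∣)
open import Data.Fin using (Fin; toℕ)
open import Data.Fin.Permutation using (Permutation′; _⟨$⟩ʳ_)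
open import Data.Bool using (Bool; true; false; if_then_else_; _∨_)
open import Data.Bool.Properties using (∨-comm)
open import Data.List using (List; []; _∷_; _++_; length)
open import Data.List.Relation.Unary.Linked using (Linked)
open import Data.List.Relation.Unary.Unique.Propositional using (Unique)
open import Data.Product using (Σ; ∃; _×_)
open import Relation.Binary.PropositionalEquality using (_≡_; refl)
open import Relation.Nullary using (¬_; does; yes; no)
open import Relation.Nullary.Decidable using (dec-false)
open import Data.Nat.Properties using (1+n≢n)

record Graph (n : ℕ) : Set where
  field
    adj    : Fin n → Fin n → Bool
    sym    : ∀ i j → adj i j ≡ adj j i
    irrefl : ∀ i → adj i i ≡ false
open Graph public

Σℕ : (n : ℕ) → (Fin n → ℕ) → ℕ
Σℕ zero    f = 0
Σℕ (suc n) f = f Data.Fin.zero ℕ.+ Σℕ n (λ i → f (Data.Fin.suc i))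

Σℚ : (n : ℕ) → (Fin n → ℚ) → ℚ
Σℚ zero    f = 0ℚ
Σℚ (suc n) f = f Data.Fin.zero ℚ.+ Σℚ n (λ i → f (Data.Fin.suc i))

b2n : Bool → ℕ
b2n true  = 1
b2n false = 0

deg : ∀ {n} → Graph n → Fin n → ℕ
deg {n} G i = Σℕ n (λ j → b2n (adj G i j))

edges : ∀ {n} → Graph n → ℕ
edges {n} G = Σℕ n (λ i → Σℕ n (λ j →
  if does (suc (toℕ i) ℕ.≤? toℕ j) then b2n (adj G i j) else 0))

ℕ→ℚ : ℕ → ℚ
ℕ→ℚ k = (+ k) / 1

-- average degree 2m/n (n = 0 never occurs in the statement; set to 0)
avgDeg : ∀ {n} → Graph n → ℚ
avgDeg {zero}  G = 0ℚ
avgDeg {suc n} G = (+ (2 ℕ.* edges G)) / suc n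

S : ∀ {n} → Graph n → ℚ
S {n} G = Σℚ n (λ i → ∣ ℕ→ℚ (deg G i) ℚ.- avgDeg G ∣)

-- 1/n as a rational (n = 0 never occurs in the statement; set to 0)
inv : ℕ → ℚ
inv zero    = 0ℚ
inv (suc n) = (+ 1) / suc n

Var : ∀ {n} → Graph n → ℚ
Var {n} G = inv n ℚ.* Σℚ n (λ i → (ℕ→ℚ (deg G i) ℚ.- avgDeg G) ℚ.* (ℕ→ℚ (deg G i) ℚ.- avgDeg G))

Ω : ∀ {n} (G : Graph n) → .{{ℚ.NonZero (S G)}} → ℚ
Ω G = Var G ÷ S G

data Walk {n} (G : Graph n) : Fin n → Fin n → Set where
  here : ∀ {u} → Walk G u u
  step : ∀ {u w v} → adj G u w ≡ true → Walk G w v → Walk G u v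

Connected : ∀ {n} → Graph n → Set
Connected G = ∀ u v → Walk G u v

-- a cycle v, x₁, …, x_k, v with k ≥ 2 (so length ≥ 3) and distinct vertices
IsCycle : ∀ {n} → Graph n → Fin n → List (Fin n) → Set
IsCycle G v xs =
  (2 ℕ.≤ length xs) × Unique (v ∷ xs) ×
  Linked (λ a b → adj G a b ≡ true) (v ∷ xs ++ v ∷ [])

Acyclic : ∀ {n} → Graph n → Set
Acyclic G = ∀ v xs → ¬ IsCycle G v xs

IsTree : ∀ {n} → Graph n → Set
IsTree G = Connected G × Acyclic G

pathAdj : ∀ {n} → Fin n → Fin n → Bool
pathAdj i j = does (suc (toℕ i) ≟ toℕ j) ∨ does (suc (toℕ j) ≟ toℕ i)

private
  noLoop : ∀ k → does (suc k ≟ k) ≡ false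
  noLoop k = dec-false (suc k ≟ k) 1+n≢n

Pathₙ : (n : ℕ) → Graph n
Pathₙ n = record
  { adj = pathAdj
  ; sym = λ i j → ∨-comm (does (suc (toℕ i) ≟ toℕ j)) (does (suc (toℕ j) ≟ toℕ i))
  ; irrefl = λ i → Relation.Binary.PropositionalEquality.cong₂ _∨_ (noLoop (toℕ i)) (noLoop (toℕ i))
  }

_≅_ : ∀ {n} → Graph n → Graph n → Set
_≅_ {n} G H = Σ (Permutation′ n) λ π → ∀ i j → adj H (π ⟨$⟩ʳ i) (π ⟨$⟩ʳ j) ≡ adj G i j

{-# OPTIONS --safe #-}
module Submission where

-- Write a = 2m/n for the average degree and xᵢ = dᵢ − a, so that Var = (1/n) Σ xᵢ², S = Σ |xᵢ| and
-- Ω ≥ 1/(2n) amounts to Σ |xᵢ| ≤ 2 Σ xᵢ².  In a tree on n ≥ 3 vertices every degree is positive and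
-- n < 2m < 2n, that is 1 < a < 2.  Since Σ xᵢ = 0, the difference 2 Σ xᵢ² − Σ |xᵢ| is the sum of
-- 2xᵢ² − |xᵢ| − (3 − 2a) xᵢ, which vanishes at a leaf (xᵢ = 1 − a) and equals 2xᵢ(dᵢ − 2) ≥ 0 at
-- every other vertex.  So equality holds exactly when all degrees are at most 2, and a tree of
-- maximum degree 2 is a path: the walk from a leaf that never turns back enumerates its vertices.

open import Defs

open import Algebra.Bundles using (CommutativeRing)
import Algebra.Properties.Semiring.Sum as SemiringSum
open import Data.Bool.Base using (Bool; true; false; if_then_else_; _∨_)
import Data.Bool.Properties as Boolₚ
open import Data.Empty using (⊥; ⊥-elim)
open import Data.Fin.Base as Fin using (Fin; toℕ)
open import Data.Fin.Permutation using (Permutation′; permutation; _⟨$⟩ʳ_)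
import Data.Fin.Properties as Finₚ
import Data.Integer.Base as ℤ
import Data.Integer.Properties as ℤₚ
open import Data.List.Base using (List; []; _∷_; length; _++_)
open import Data.List.Membership.Propositional using (_∈_; _∉_)
open import Data.List.Relation.Unary.All using (All; []; _∷_)
open import Data.List.Relation.Unary.AllPairs using ([]; _∷_)
open import Data.List.Relation.Unary.Any using (here; there; any?)
open import Data.List.Relation.Unary.Linked as Linked using (Linked; []; [-]; _∷_)
open import Data.List.Relation.Unary.Unique.Propositional using (Unique)
open import Data.Nat as ℕ using (ℕ; zero; suc; _+_; _*_; _≤_; _<_; _⊓_; z≤n; s≤s)
import Data.Nat.Properties as ℕₚ
open import Data.Product using (Σ; ∃; _×_; _,_; proj₁; proj₂)
open import Data.Rational as ℚ
  using (ℚ; 0ℚ; 1ℚ; toℚᵘ; NonZero; Positive; NonNegative; positive; nonNegative) renaming (_≤_ to _≤ℚ_)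
import Data.Rational.Properties as ℚₚ
open import Data.Rational.Solver using (module +-*-Solver)
open import Data.Rational.Unnormalised as ℚᵘ using (mkℚᵘ; *≡*) renaming (_≃_ to _≃ᵘ_)
import Data.Rational.Unnormalised.Properties as ℚᵘₚ
open import Data.Sum using (_⊎_; inj₁; inj₂; [_,_]′)
open import Function.Base using (_∘_)
open import Function.Bundles using (_⇔_; mk⇔)
open import Function.Properties.Equivalence using () renaming (trans to ⇔-trans)
open import Relation.Binary.Definitions using (tri<; tri≈; tri>)
open import Relation.Binary.PropositionalEquality
  using (_≡_; _≢_; refl; trans; cong; cong₂; subst; subst₂; module ≡-Reasoning)
import Relation.Binary.PropositionalEquality as ≡
open import Relation.Nullary using (¬_; Dec; yes; no; does; contradiction; ¬?; _×-dec_)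
open import Relation.Nullary.Decidable using (dec-true; dec-false)
open import Relation.Nullary.Reflects using (ofʸ; ofⁿ)

-- Finite sums

module ΣN = SemiringSum ℕₚ.+-*-semiring

Σℕ≡sum : ∀ n (f : Fin n → ℕ) → Σℕ n f ≡ ΣN.sum f
Σℕ≡sum zero    f = refl
Σℕ≡sum (suc n) f = cong (f Fin.zero +_) (Σℕ≡sum n (f ∘ Fin.suc))

Σℕ-cong : ∀ n {f g : Fin n → ℕ} → (∀ i → f i ≡ g i) → Σℕ n f ≡ Σℕ n g
Σℕ-cong zero    f≗g = refl
Σℕ-cong (suc n) f≗g = cong₂ _+_ (f≗g Fin.zero) (Σℕ-cong n (f≗g ∘ Fin.suc))

Σℕ-mono-≤ : ∀ n {f g : Fin n → ℕ} → (∀ i → f i ≤ g i) → Σℕ n f ≤ Σℕ n g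
Σℕ-mono-≤ zero    f≤g = z≤n
Σℕ-mono-≤ (suc n) f≤g = ℕₚ.+-mono-≤ (f≤g Fin.zero) (Σℕ-mono-≤ n (f≤g ∘ Fin.suc))

Σℕ-const : ∀ n c → Σℕ n (λ _ → c) ≡ n * c
Σℕ-const zero    c = refl
Σℕ-const (suc n) c = cong (c +_) (Σℕ-const n c)

Σℕ-zero : ∀ n → Σℕ n (λ _ → 0) ≡ 0
Σℕ-zero n = trans (Σℕ-const n 0) (ℕₚ.*-zeroʳ n)

Σℕ-one : ∀ n → Σℕ n (λ _ → 1) ≡ n
Σℕ-one n = trans (Σℕ-const n 1) (ℕₚ.*-identityʳ n)

Σℕ-distrib-+ : ∀ n (f g : Fin n → ℕ) → Σℕ n (λ i → f i + g i) ≡ Σℕ n f + Σℕ n g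
Σℕ-distrib-+ n f g
  rewrite Σℕ≡sum n (λ i → f i + g i) | Σℕ≡sum n f | Σℕ≡sum n g = ΣN.∑-distrib-+ f g

Σℕ-comm : ∀ n (f : Fin n → Fin n → ℕ) →
          Σℕ n (λ i → Σℕ n (f i)) ≡ Σℕ n (λ j → Σℕ n (λ i → f i j))
Σℕ-comm n f = begin
  Σℕ n (λ i → Σℕ n (f i))               ≡⟨ Σℕ≡sum n _ ⟩
  ΣN.sum (λ i → Σℕ n (f i))             ≡⟨ ΣN.sum-cong-≗ (λ i → Σℕ≡sum n (f i)) ⟩
  ΣN.sum (λ i → ΣN.sum (f i))           ≡⟨ ΣN.∑-comm f ⟩
  ΣN.sum (λ j → ΣN.sum (λ i → f i j))   ≡⟨ ΣN.sum-cong-≗ (λ j → Σℕ≡sum n (λ i → f i j)) ⟨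
  ΣN.sum (λ j → Σℕ n (λ i → f i j))     ≡⟨ Σℕ≡sum n _ ⟨
  Σℕ n (λ j → Σℕ n (λ i → f i j))       ∎
  where open ≡-Reasoning

Σℕ-select : ∀ n (a : Fin n) (h : Fin n → ℕ) →
            Σℕ n (λ j → if does (j Finₚ.≟ a) then h j else 0) ≡ h a
Σℕ-select (suc n) Fin.zero    h = trans (cong (h Fin.zero +_) (Σℕ-zero n)) (ℕₚ.+-identityʳ _)
Σℕ-select (suc n) (Fin.suc a) h = Σℕ-select n a (h ∘ Fin.suc)

indicator : ∀ {n} → Fin n → Fin n → ℕ
indicator a j = if does (j Finₚ.≟ a) then 1 else 0

if-≟-cases : ∀ {n} (i a : Fin n) {A : Set} (x y : A) →
             (i ≡ a × (if does (i Finₚ.≟ a) then x else y) ≡ x) ⊎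
             (i ≢ a × (if does (i Finₚ.≟ a) then x else y) ≡ y)
if-≟-cases i a x y with i Finₚ.≟ a
... | yes i≡a = inj₁ (i≡a , refl)
... | no  i≢a = inj₂ (i≢a , refl)

Σℕ-indicator : ∀ n (a : Fin n) → Σℕ n (indicator a) ≡ 1
Σℕ-indicator n a = Σℕ-select n a (λ _ → 1)

-- Degrees and neighbourhoods

Adjacent : ∀ {n} → Graph n → Fin n → Fin n → Set
Adjacent G u v = adj G u v ≡ true

module _ {n} (G : Graph n) where

  Adjacent-sym : ∀ {u v} → Adjacent G u v → Adjacent G v u
  Adjacent-sym {u} {v} u~v = trans (Graph.sym G v u) u~v

  Adjacent⇒≢ : ∀ {u v} → Adjacent G u v → u ≢ v
  Adjacent⇒≢ {u} u~u refl with trans (≡.sym u~u) (irrefl G u)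
  ... | ()

module _ {n : ℕ} where

  multiplicity : List (Fin n) → Fin n → ℕ
  multiplicity []      j = 0
  multiplicity (e ∷ L) j = indicator e j + multiplicity L j

  Σℕ-multiplicity : ∀ L → Σℕ n (multiplicity L) ≡ length L
  Σℕ-multiplicity []      = Σℕ-zero n
  Σℕ-multiplicity (e ∷ L) = begin
    Σℕ n (λ j → indicator e j + multiplicity L j)      ≡⟨ Σℕ-distrib-+ n (indicator e) (multiplicity L) ⟩
    Σℕ n (indicator e) + Σℕ n (multiplicity L)         ≡⟨ cong₂ _+_ (Σℕ-indicator n e) (Σℕ-multiplicity L) ⟩
    suc (length L)                                     ∎
    where open ≡-Reasoning

  indicator-≢ : ∀ {a j : Fin n} → j ≢ a → indicator a j ≡ 0
  indicator-≢ {a} {j} j≢a with j Finₚ.≟ a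
  ... | yes j≡a = contradiction j≡a j≢a
  ... | no  _   = refl

  ∈⇒1≤multiplicity : ∀ {L} {j : Fin n} → j ∈ L → 1 ≤ multiplicity L j
  ∈⇒1≤multiplicity {e ∷ L} {j} (here refl) with j Finₚ.≟ j
  ... | yes _   = s≤s z≤n
  ... | no  j≢j = contradiction refl j≢j
  ∈⇒1≤multiplicity {e ∷ L} {j} (there j∈L) =
    ℕₚ.≤-trans (∈⇒1≤multiplicity j∈L) (ℕₚ.m≤n+m (multiplicity L j) (indicator e j))

  ∉⇒multiplicity≡0 : ∀ {L} {j : Fin n} → j ∉ L → multiplicity L j ≡ 0
  ∉⇒multiplicity≡0 {[]}    j∉L = refl
  ∉⇒multiplicity≡0 {e ∷ L} j∉L = cong₂ _+_ (indicator-≢ (j∉L ∘ here)) (∉⇒multiplicity≡0 (j∉L ∘ there))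

  unique⇒multiplicity≤1 : ∀ {L : List (Fin n)} → Unique L → ∀ j → multiplicity L j ≤ 1
  unique⇒multiplicity≤1 {[]}    []           j = z≤n
  unique⇒multiplicity≤1 {e ∷ L} (e∉L ∷ uniq) j with j Finₚ.≟ e
  ... | yes refl = ℕₚ.≤-reflexive (cong suc (∉⇒multiplicity≡0 (All⇒∉ e∉L)))
    where
    All⇒∉ : ∀ {L′} → All (e ≢_) L′ → e ∉ L′
    All⇒∉ (e≢x ∷ _)  (here e≡x)  = e≢x e≡x
    All⇒∉ (_ ∷ e∉xs) (there e∈xs) = All⇒∉ e∉xs e∈xs
  ... | no  _    = unique⇒multiplicity≤1 uniq j


module _ {n} (G : Graph n) where

  length≤deg : ∀ x {L} → Unique L → All (Adjacent G x) L → length L ≤ deg G x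
  length≤deg x {L} uniq x~L = subst (_≤ deg G x) (Σℕ-multiplicity L) (Σℕ-mono-≤ n bound)
    where
    All-∈ : ∀ {L′ j} → All (Adjacent G x) L′ → j ∈ L′ → Adjacent G x j
    All-∈ (x~j ∷ _)   (here refl)  = x~j
    All-∈ (_ ∷ x~L′) (there j∈L′) = All-∈ x~L′ j∈L′
    bound : ∀ j → multiplicity L j ≤ b2n (adj G x j)
    bound j with any? (j Finₚ.≟_) L
    ... | yes j∈L = subst (λ b → multiplicity L j ≤ b2n b) (≡.sym (All-∈ x~L j∈L))
                          (unique⇒multiplicity≤1 uniq j)
    ... | no  j∉L = subst (_≤ b2n (adj G x j)) (≡.sym (∉⇒multiplicity≡0 j∉L)) z≤n

  deg≤length : ∀ x L → (∀ {j} → Adjacent G x j → j ∈ L) → deg G x ≤ length L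
  deg≤length x L x~j⇒j∈L = subst (deg G x ≤_) (Σℕ-multiplicity L) (Σℕ-mono-≤ n bound)
    where
    bound : ∀ j → b2n (adj G x j) ≤ multiplicity L j
    bound j with adj G x j in x~j
    ... | true  = ∈⇒1≤multiplicity (x~j⇒j∈L x~j)
    ... | false = z≤n

  neighbour-∉ : ∀ x L → length L < deg G x → ∃ λ j → Adjacent G x j × j ∉ L
  neighbour-∉ x L L<deg with Finₚ.any? (λ j → (adj G x j Boolₚ.≟ true) ×-dec ¬? (any? (j Finₚ.≟_) L))
  ... | yes found = found
  ... | no  none  = contradiction (deg≤length x L listed) (ℕₚ.<⇒≱ L<deg)
    where
    listed : ∀ {j} → Adjacent G x j → j ∈ L
    listed {j} x~j with any? (j Finₚ.≟_) L
    ... | yes j∈L = j∈L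
    ... | no  j∉L = contradiction (j , x~j , j∉L) none

  neighbour : ∀ x → 1 ≤ deg G x → ∃ (Adjacent G x)
  neighbour x 1≤deg = let j , x~j , _ = neighbour-∉ x [] 1≤deg in j , x~j

  neighbour-≢ : ∀ x → 2 ≤ deg G x → ∀ p → ∃ λ j → Adjacent G x j × j ≢ p
  neighbour-≢ x 2≤deg p =
    let j , x~j , j∉[p] = neighbour-∉ x (p ∷ []) 2≤deg in j , x~j , j∉[p] ∘ here

  neighbour-≢₂ : ∀ x → 3 ≤ deg G x → ∀ p q → ∃ λ j → Adjacent G x j × j ≢ p × j ≢ q
  neighbour-≢₂ x 3≤deg p q =
    let j , x~j , j∉[p,q] = neighbour-∉ x (p ∷ q ∷ []) 3≤deg
    in  j , x~j , j∉[p,q] ∘ here , j∉[p,q] ∘ there ∘ here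

  Adjacent⇒1≤deg : ∀ {x y} → Adjacent G x y → 1 ≤ deg G x
  Adjacent⇒1≤deg x~y = length≤deg _ ([] ∷ []) (x~y ∷ [])

  deg≤1⇒neighbour-unique : ∀ {x a y} → deg G x ≤ 1 → Adjacent G x a → Adjacent G x y → y ≡ a
  deg≤1⇒neighbour-unique {x} {a} {y} deg≤1 x~a x~y with y Finₚ.≟ a
  ... | yes y≡a = y≡a
  ... | no  y≢a = contradiction (length≤deg x ((y≢a ∷ []) ∷ [] ∷ []) (x~y ∷ x~a ∷ []))
                                (ℕₚ.<⇒≱ (s≤s deg≤1))

  deg≤2⇒neighbours : ∀ {x a b y} → deg G x ≤ 2 → Adjacent G x a → Adjacent G x b → a ≢ b →
                     Adjacent G x y → y ≡ a ⊎ y ≡ b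
  deg≤2⇒neighbours {x} {a} {b} {y} deg≤2 x~a x~b a≢b x~y with y Finₚ.≟ a | y Finₚ.≟ b
  ... | yes y≡a | _       = inj₁ y≡a
  ... | no  _   | yes y≡b = inj₂ y≡b
  ... | no  y≢a | no  y≢b =
    contradiction (length≤deg x ((y≢a ∷ y≢b ∷ []) ∷ (a≢b ∷ []) ∷ [] ∷ []) (x~y ∷ x~a ∷ x~b ∷ []))
                  (ℕₚ.<⇒≱ (s≤s deg≤2))

degreeSum : ∀ {n} → Graph n → ℕ
degreeSum {n} G = Σℕ n (deg G)

module _ {n} (G : Graph n) where

  private
    forward : Fin n → Fin n → ℕ
    forward i j = if does (suc (toℕ i) ℕ.≤? toℕ j) then b2n (adj G i j) else 0

    b2n-adj≡forward+forward : ∀ i j → b2n (adj G i j) ≡ forward i j + forward j i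
    b2n-adj≡forward+forward i j
      with toℕ i ℕ.<ᵇ toℕ j | ℕₚ.<ᵇ-reflects-< (toℕ i) (toℕ j)
         | toℕ j ℕ.<ᵇ toℕ i | ℕₚ.<ᵇ-reflects-< (toℕ j) (toℕ i)
    ... | true  | ofʸ i<j | true  | ofʸ j<i = contradiction i<j (ℕₚ.<-asym j<i)
    ... | true  | ofʸ _   | false | ofⁿ _   = ≡.sym (ℕₚ.+-identityʳ _)
    ... | false | ofⁿ _   | true  | ofʸ _   = cong b2n (Graph.sym G i j)
    ... | false | ofⁿ i≮j | false | ofⁿ j≮i = subst (λ k → b2n (adj G i k) ≡ 0) i≡j (cong b2n (irrefl G i))
      where
      i≡j : i ≡ j
      i≡j = Finₚ.toℕ-injective (ℕₚ.≤-antisym (ℕₚ.≮⇒≥ j≮i) (ℕₚ.≮⇒≥ i≮j))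

  handshake : degreeSum G ≡ 2 * edges G
  handshake = begin
    Σℕ n (λ i → Σℕ n (λ j → b2n (adj G i j)))
      ≡⟨ Σℕ-cong n (λ i → Σℕ-cong n (b2n-adj≡forward+forward i)) ⟩
    Σℕ n (λ i → Σℕ n (λ j → forward i j + forward j i))
      ≡⟨ Σℕ-cong n (λ i → Σℕ-distrib-+ n (forward i) (λ j → forward j i)) ⟩
    Σℕ n (λ i → Σℕ n (forward i) + Σℕ n (λ j → forward j i))
      ≡⟨ Σℕ-distrib-+ n _ _ ⟩
    edges G + Σℕ n (λ i → Σℕ n (λ j → forward j i))
      ≡⟨ cong (edges G +_) (Σℕ-comm n (λ i j → forward j i)) ⟩
    edges G + edges G
      ≡⟨ cong (edges G +_) (ℕₚ.+-identityʳ (edges G)) ⟨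
    2 * edges G
      ∎
    where open ≡-Reasoning

-- Acyclic graphs

module NonBacktracking {n} (G : Graph n) (w : ℕ → Fin n)
  (w-adj : ∀ k → Adjacent G (w k) (w (suc k)))
  (w-nb : ∀ k → w (suc (suc k)) ≢ w k) where

  DistinctBelow : ℕ → Set
  DistinctBelow k = ∀ a b → a < b → b < k → w a ≢ w b

  FirstRepeat : Set
  FirstRepeat = ∃ λ j → ∃ λ i → i < j × w i ≡ w j × DistinctBelow j

  distinct⊎firstRepeat : ∀ N → DistinctBelow (suc N) ⊎ FirstRepeat
  distinct⊎firstRepeat zero = inj₁ λ { _ zero () _ ; _ (suc _) _ (s≤s ()) }
  distinct⊎firstRepeat (suc N) with distinct⊎firstRepeat N
  ... | inj₂ repeat = inj₂ repeat
  ... | inj₁ d with Finₚ.any? (λ (i : Fin (suc N)) → w (toℕ i) Finₚ.≟ w (suc N))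
  ...   | yes (i , wi≡w) = inj₂ (suc N , toℕ i , Finₚ.toℕ<n i , wi≡w , d)
  ...   | no  new        = inj₁ distinct
    where
    distinct : DistinctBelow (suc (suc N))
    distinct a b a<b (s≤s b≤N+1) with ℕₚ.m≤n⇒m<n∨m≡n b≤N+1
    ... | inj₁ b<N+1 = d a b a<b b<N+1
    ... | inj₂ refl  = λ wa≡wb → new (Fin.fromℕ< a<b , trans (cong w (Finₚ.toℕ-fromℕ< a<b)) wa≡wb)

  firstRepeat : FirstRepeat
  firstRepeat with distinct⊎firstRepeat n
  ... | inj₂ repeat = repeat
  ... | inj₁ d with Finₚ.pigeonhole (ℕₚ.n<1+n n) (w ∘ toℕ)
  ...   | i , j , i<j , wi≡wj = contradiction wi≡wj (d (toℕ i) (toℕ j) i<j (Finₚ.toℕ<n j))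

  segment : ℕ → ℕ → List (Fin n)
  segment i zero    = []
  segment i (suc L) = w i ∷ segment (suc i) L

  length-segment : ∀ i L → length (segment i L) ≡ L
  length-segment i zero    = refl
  length-segment i (suc L) = cong suc (length-segment (suc i) L)

  All-segment : ∀ {P : Fin n → Set} i L → (∀ k → i ≤ k → k < i + L → P (w k)) → All P (segment i L)
  All-segment i zero    P-w = []
  All-segment i (suc L) P-w =
    P-w i ℕₚ.≤-refl (ℕₚ.m<m+n i (s≤s z≤n)) ∷
    All-segment (suc i) L λ k i<k k<i+1+L →
      P-w k (ℕₚ.<⇒≤ i<k) (subst (k <_) (≡.sym (ℕₚ.+-suc i L)) k<i+1+L)

  unique-segment : ∀ i L → (∀ a b → i ≤ a → a < b → b < i + L → w a ≢ w b) →
                   Unique (segment i L)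
  unique-segment i zero    distinct = []
  unique-segment i (suc L) distinct =
    All-segment (suc i) L (λ k i<k k<i+1+L →
      distinct i k ℕₚ.≤-refl i<k (subst (k <_) (≡.sym (ℕₚ.+-suc i L)) k<i+1+L)) ∷
    unique-segment (suc i) L (λ a b i<a a<b b<i+1+L →
      distinct a b (ℕₚ.<⇒≤ i<a) a<b (subst (b <_) (≡.sym (ℕₚ.+-suc i L)) b<i+1+L))

  linked-segment : ∀ i L {x} → Adjacent G (w (i + L)) x →
                   Linked (Adjacent G) (w i ∷ segment (suc i) L ++ x ∷ [])
  linked-segment i zero    {x} wi~x =
    subst (λ k → Adjacent G (w k) x) (ℕₚ.+-identityʳ i) wi~x ∷ [-]
  linked-segment i (suc L) {x} wi+L~x =
    w-adj i ∷ linked-segment (suc i) L (subst (λ k → Adjacent G (w k) x) (ℕₚ.+-suc i L) wi+L~x)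

  -- The first repetition wᵢ = wⱼ closes the cycle wᵢ, …, wⱼ₋₁; it has length j − i ≥ 3
  -- because G has no loops and w never turns straight back.
  ¬acyclic : ¬ Acyclic G
  ¬acyclic acyclic with firstRepeat
  ... | j , i , i<j , wi≡wj , distinct with ℕₚ.m≤n⇒∃[o]m+o≡n i<j
  ... | zero , refl =
    Adjacent⇒≢ G (w-adj i) (trans wi≡wj (cong w (cong suc (ℕₚ.+-identityʳ i))))
  ... | suc zero , refl =
    w-nb i (trans (cong w (cong suc (ℕₚ.+-comm 1 i))) (≡.sym wi≡wj))
  ... | suc (suc k) , refl = acyclic (w i) (segment (suc i) L) cycle
    where
    L : ℕ
    L = suc (suc k)
    cycle : IsCycle G (w i) (segment (suc i) L)
    cycle = subst (2 ≤_) (≡.sym (length-segment (suc i) L)) (s≤s (s≤s z≤n))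
          , unique-segment i (suc L)
              (λ a b _ a<b b<i+1+L → distinct a b a<b (subst (b <_) (ℕₚ.+-suc i L) b<i+1+L))
          , linked-segment i L (subst (Adjacent G (w (i + L))) (≡.sym wi≡wj) (w-adj (i + L)))

module WalkFrom {n} (G : Graph n) (next : ∀ p v → Adjacent G p v → ∃ (Adjacent G v))
  {u₀ u₁ : Fin n} (u₀~u₁ : Adjacent G u₀ u₁) where

  private
    Arc : Set
    Arc = ∃ λ p → ∃ (Adjacent G p)

    advance : Arc → Arc
    advance (p , v , p~v) = v , next p v p~v

    arc : ℕ → Arc
    arc zero    = u₀ , u₁ , u₀~u₁
    arc (suc k) = advance (arc k)

  walk : ℕ → Fin n
  walk k = proj₁ (arc k)

  walk-adj : ∀ k → Adjacent G (walk k) (walk (suc k))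
  walk-adj k = proj₂ (proj₂ (arc k))

Σℕ-positive : ∀ n (f : Fin n → ℕ) → 1 ≤ Σℕ n f → ∃ λ i → 1 ≤ f i
Σℕ-positive (suc n) f 1≤Σ with f Fin.zero in f₀≡
... | suc _ = Fin.zero , subst (1 ≤_) (≡.sym f₀≡) (s≤s z≤n)
... | zero  = let i , 1≤fi = Σℕ-positive n (f ∘ Fin.suc) 1≤Σ in Fin.suc i , 1≤fi

acyclic⇒leaf : ∀ {n} (G : Graph n) → Acyclic G → 1 ≤ degreeSum G → ∃ λ v → deg G v ≡ 1
acyclic⇒leaf {n} G acyclic 1≤Σdeg with Finₚ.any? (λ v → deg G v ℕ.≟ 1)
... | yes leaf  = leaf
... | no  ¬leaf = contradiction acyclic (NonBacktracking.¬acyclic G W.walk W.walk-adj nb)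
  where
  2≤deg : ∀ {p v} → Adjacent G p v → 2 ≤ deg G v
  2≤deg {p} {v} p~v with deg G v in deg≡ | Adjacent⇒1≤deg G (Adjacent-sym G p~v)
  ... | suc zero    | _ = contradiction (v , deg≡) ¬leaf
  ... | suc (suc _) | _ = s≤s (s≤s z≤n)
  onward : ∀ p v → Adjacent G p v → ∃ λ u → Adjacent G v u × u ≢ p
  onward p v p~v = neighbour-≢ G v (2≤deg p~v) p
  next : ∀ p v → Adjacent G p v → ∃ (Adjacent G v)
  next p v p~v = let u , v~u , _ = onward p v p~v in u , v~u
  start : ∃ λ u → 1 ≤ deg G u
  start = Σℕ-positive n (deg G) 1≤Σdeg
  first-edge : ∃ (Adjacent G (proj₁ start))
  first-edge = neighbour G (proj₁ start) (proj₂ start)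
  module W = WalkFrom G next (proj₂ first-edge)
  nb : ∀ k → W.walk (suc (suc k)) ≢ W.walk k
  nb k = proj₂ (proj₂ (onward (W.walk k) (W.walk (suc k)) (W.walk-adj k)))

module _ {n} (G : Graph n) (v : Fin n) where

  private
    touches-v : Fin n → Fin n → Bool
    touches-v i j = does (i Finₚ.≟ v) ∨ does (j Finₚ.≟ v)

    adj-isolate : Fin n → Fin n → Bool
    adj-isolate i j = if touches-v i j then false else adj G i j

    adj-isolate-sym : ∀ i j → adj-isolate i j ≡ adj-isolate j i
    adj-isolate-sym i j with i Finₚ.≟ v | j Finₚ.≟ v
    ... | yes _ | yes _ = refl
    ... | yes _ | no  _ = refl
    ... | no  _ | yes _ = refl
    ... | no  _ | no  _ = Graph.sym G i j

    adj-isolate-irrefl : ∀ i → adj-isolate i i ≡ false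
    adj-isolate-irrefl i with i Finₚ.≟ v
    ... | yes _ = refl
    ... | no  _ = irrefl G i

  isolate : Graph n
  isolate = record { adj = adj-isolate ; sym = adj-isolate-sym ; irrefl = adj-isolate-irrefl }

  isolate-⊆ : ∀ {i j} → Adjacent isolate i j → Adjacent G i j
  isolate-⊆ {i} {j} i~j with touches-v i j
  ... | false = i~j

  isolate-acyclic : Acyclic G → Acyclic isolate
  isolate-acyclic acyclic u xs (length≥2 , unique , linked) =
    acyclic u xs (length≥2 , unique , Linked.map isolate-⊆ linked)

  deg-isolate≤deg : ∀ i → deg isolate i ≤ deg G i
  deg-isolate≤deg i = Σℕ-mono-≤ n (λ j → b2n-mono (isolate-⊆ {i} {j}))
    where
    b2n-mono : ∀ {a b} → (a ≡ true → b ≡ true) → b2n a ≤ b2n b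
    b2n-mono {false} _    = z≤n
    b2n-mono {true}  a⇒b rewrite a⇒b refl = ℕₚ.≤-refl

  deg-isolate-self : deg isolate v ≡ 0
  deg-isolate-self = trans (Σℕ-cong n isolated) (Σℕ-zero n)
    where
    isolated : ∀ j → b2n (adj-isolate v j) ≡ 0
    isolated j with v Finₚ.≟ v
    ... | yes _   = refl
    ... | no  v≢v = contradiction refl v≢v

  deg-isolate-≢ : ∀ {i} → i ≢ v → deg isolate i + b2n (adj G v i) ≡ deg G i
  deg-isolate-≢ {i} i≢v = begin
    deg isolate i + b2n (adj G v i)
      ≡⟨ cong (deg isolate i +_) (cong b2n (Graph.sym G v i)) ⟩
    deg isolate i + b2n (adj G i v)
      ≡⟨ cong (deg isolate i +_) (Σℕ-select n v (λ j → b2n (adj G i j))) ⟨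
    deg isolate i + Σℕ n (λ j → if does (j Finₚ.≟ v) then b2n (adj G i j) else 0)
      ≡⟨ Σℕ-distrib-+ n _ _ ⟨
    Σℕ n (λ j → b2n (adj-isolate i j) + (if does (j Finₚ.≟ v) then b2n (adj G i j) else 0))
      ≡⟨ Σℕ-cong n split ⟩
    deg G i
      ∎
    where
    open ≡-Reasoning
    split : ∀ j → b2n (adj-isolate i j) + (if does (j Finₚ.≟ v) then b2n (adj G i j) else 0)
                ≡ b2n (adj G i j)
    split j with i Finₚ.≟ v | j Finₚ.≟ v
    ... | yes i≡v | _     = contradiction i≡v i≢v
    ... | no  _   | yes _ = refl
    ... | no  _   | no  _ = ℕₚ.+-identityʳ _

  degreeSum-isolate : degreeSum isolate + deg G v + deg G v ≡ degreeSum G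
  degreeSum-isolate = begin
    degreeSum isolate + deg G v + deg G v
      ≡⟨ cong₂ _+_ (Σℕ-distrib-+ n (deg isolate) (λ i → b2n (adj G v i))) (Σℕ-select n v (λ _ → deg G v)) ⟨
    Σℕ n (λ i → deg isolate i + b2n (adj G v i)) + Σℕ n (λ i → if does (i Finₚ.≟ v) then deg G v else 0)
      ≡⟨ Σℕ-distrib-+ n _ _ ⟨
    Σℕ n (λ i → deg isolate i + b2n (adj G v i) + (if does (i Finₚ.≟ v) then deg G v else 0))
      ≡⟨ Σℕ-cong n split ⟩
    degreeSum G
      ∎
    where
    open ≡-Reasoning
    split : ∀ i → deg isolate i + b2n (adj G v i) + (if does (i Finₚ.≟ v) then deg G v else 0) ≡ deg G i
    split i with if-≟-cases i v (deg G v) 0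
    ... | inj₁ (refl , sel) =
      trans (cong (deg isolate v + b2n (adj G v v) +_) sel)
            (cong₂ (λ d e → d + b2n e + deg G v) deg-isolate-self (irrefl G v))
    ... | inj₂ (i≢v , sel) =
      trans (cong (deg isolate i + b2n (adj G v i) +_) sel) (trans (ℕₚ.+-identityʳ _) (deg-isolate-≢ i≢v))

nonIsolated : ∀ {n} → Graph n → ℕ
nonIsolated {n} G = Σℕ n (λ i → 1 ⊓ deg G i)

module _ {n} (G : Graph n) where

  isolate-leaf : ∀ {v} → deg G v ≡ 1 → nonIsolated (isolate G v) + 1 ≤ nonIsolated G
  isolate-leaf {v} deg≡1 = begin
    nonIsolated (isolate G v) + 1
      ≡⟨ cong (nonIsolated (isolate G v) +_) (Σℕ-indicator n v) ⟨
    nonIsolated (isolate G v) + Σℕ n (indicator v)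
      ≡⟨ Σℕ-distrib-+ n _ (indicator v) ⟨
    Σℕ n (λ i → 1 ⊓ deg (isolate G v) i + indicator v i)
      ≤⟨ Σℕ-mono-≤ n pointwise ⟩
    nonIsolated G
      ∎
    where
    open ℕₚ.≤-Reasoning
    pointwise : ∀ i → 1 ⊓ deg (isolate G v) i + indicator v i ≤ 1 ⊓ deg G i
    pointwise i with if-≟-cases i v 1 0
    ... | inj₁ (refl , ind≡1) rewrite ind≡1 | deg-isolate-self G i | deg≡1 = ℕₚ.≤-refl
    ... | inj₂ (_    , ind≡0) rewrite ind≡0 | ℕₚ.+-identityʳ (1 ⊓ deg (isolate G v) i) =
      ℕₚ.⊓-monoʳ-≤ 1 (deg-isolate≤deg G v i)

  Adjacent⇒2≤nonIsolated : ∀ {u v} → Adjacent G u v → 2 ≤ nonIsolated G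
  Adjacent⇒2≤nonIsolated {u} {v} u~v = begin
    2                                         ≡⟨ cong₂ _+_ (Σℕ-indicator n u) (Σℕ-indicator n v) ⟨
    Σℕ n (indicator u) + Σℕ n (indicator v)   ≡⟨ Σℕ-distrib-+ n (indicator u) (indicator v) ⟨
    Σℕ n (λ i → indicator u i + indicator v i) ≤⟨ Σℕ-mono-≤ n pointwise ⟩
    nonIsolated G                             ∎
    where
    open ℕₚ.≤-Reasoning
    1≤1⊓ : ∀ {d} → 1 ≤ d → 1 ≤ 1 ⊓ d
    1≤1⊓ (s≤s _) = s≤s z≤n
    pointwise : ∀ i → indicator u i + indicator v i ≤ 1 ⊓ deg G i
    pointwise i with i Finₚ.≟ u | i Finₚ.≟ v
    ... | yes refl | yes refl = contradiction refl (Adjacent⇒≢ G u~v)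
    ... | yes refl | no  _    = 1≤1⊓ (Adjacent⇒1≤deg G u~v)
    ... | no  _    | yes refl = 1≤1⊓ (Adjacent⇒1≤deg G (Adjacent-sym G u~v))
    ... | no  _    | no  _    = z≤n

-- Isolating a leaf lowers the degree sum by 2 and the number of non-isolated vertices by at least 1.
acyclic⇒degreeSum<2*nonIsolated : ∀ {n} (G : Graph n) → Acyclic G →
                                   degreeSum G ≡ 0 ⊎ degreeSum G < 2 * nonIsolated G
acyclic⇒degreeSum<2*nonIsolated G = bounded (degreeSum G) G ℕₚ.≤-refl
  where
  bounded : ∀ k {n} (G : Graph n) → degreeSum G ≤ k → Acyclic G →
            degreeSum G ≡ 0 ⊎ degreeSum G < 2 * nonIsolated G
  bounded zero    G Σ≤0 _ = inj₁ (ℕₚ.n≤0⇒n≡0 Σ≤0)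
  bounded (suc k) {n} G Σ≤k+1 acyclic with degreeSum G in Σ≡
  ... | zero  = inj₁ refl
  ... | suc _ = inj₂ (subst (_< 2 * nonIsolated G) Σ≡ Σ<)
    where
    leaf : ∃ λ v → deg G v ≡ 1
    leaf = acyclic⇒leaf G acyclic (subst (1 ≤_) (≡.sym Σ≡) (s≤s z≤n))
    v : Fin n
    v = proj₁ leaf
    v~u : ∃ (Adjacent G v)
    v~u = neighbour G v (ℕₚ.≤-reflexive (≡.sym (proj₂ leaf)))
    G′ : Graph n
    G′ = isolate G v
    Σ′+2≡Σ : degreeSum G′ + 2 ≡ degreeSum G
    Σ′+2≡Σ = begin
      degreeSum G′ + 2                     ≡⟨ cong (degreeSum G′ +_) (cong₂ _+_ (proj₂ leaf) (proj₂ leaf)) ⟨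
      degreeSum G′ + (deg G v + deg G v)   ≡⟨ ℕₚ.+-assoc (degreeSum G′) _ _ ⟨
      degreeSum G′ + deg G v + deg G v     ≡⟨ degreeSum-isolate G v ⟩
      degreeSum G                          ∎
      where open ≡-Reasoning
    Σ′≤k : degreeSum G′ ≤ k
    Σ′≤k = ℕₚ.≤-pred (ℕₚ.≤-trans (subst (degreeSum G′ <_) Σ′+2≡Σ (ℕₚ.m<m+n _ (s≤s z≤n)))
                                   (subst (_≤ suc k) (≡.sym Σ≡) Σ≤k+1))
    Σ< : degreeSum G < 2 * nonIsolated G
    Σ< with bounded k G′ Σ′≤k (isolate-acyclic G v acyclic)
    ... | inj₁ Σ′≡0 = begin-strict
      degreeSum G            ≡⟨ trans (≡.sym Σ′+2≡Σ) (cong (_+ 2) Σ′≡0) ⟩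
      2                      <⟨ ℕₚ.n<1+n 2 ⟩
      3                      ≤⟨ ℕₚ.n≤1+n 3 ⟩
      2 * 2                  ≤⟨ ℕₚ.*-monoʳ-≤ 2 (Adjacent⇒2≤nonIsolated G (Adjacent-sym G (proj₂ v~u))) ⟩
      2 * nonIsolated G      ∎
      where open ℕₚ.≤-Reasoning
    ... | inj₂ Σ′<2N′ = begin-strict
      degreeSum G                     ≡⟨ Σ′+2≡Σ ⟨
      degreeSum G′ + 2                <⟨ ℕₚ.+-monoˡ-< 2 Σ′<2N′ ⟩
      2 * nonIsolated G′ + 2 * 1      ≡⟨ ℕₚ.*-distribˡ-+ 2 (nonIsolated G′) 1 ⟨
      2 * (nonIsolated G′ + 1)        ≤⟨ ℕₚ.*-monoʳ-≤ 2 (isolate-leaf G (proj₂ leaf)) ⟩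
      2 * nonIsolated G               ∎
      where open ℕₚ.≤-Reasoning

-- Trees and paths

module _ {n} (G : Graph n) where

  walk-start : ∀ {u v} → Walk G u v → u ≢ v → ∃ (Adjacent G u)
  walk-start here             u≢u = contradiction refl u≢u
  walk-start (step u~w _) _   = _ , u~w

  nonIsolated≡n : (∀ i → 1 ≤ deg G i) → nonIsolated G ≡ n
  nonIsolated≡n 1≤deg = trans (Σℕ-cong n one) (Σℕ-one n)
    where
    one : ∀ i → 1 ⊓ deg G i ≡ 1
    one i with deg G i | 1≤deg i
    ... | suc _ | _ = refl

  n≤degreeSum : (∀ i → 1 ≤ deg G i) → n ≤ degreeSum G
  n≤degreeSum 1≤deg = subst (_≤ degreeSum G) (Σℕ-one n) (Σℕ-mono-≤ n 1≤deg)

  n<degreeSum : (∀ i → 1 ≤ deg G i) → ∀ {i₀} → 2 ≤ deg G i₀ → n < degreeSum G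
  n<degreeSum 1≤deg {i₀} 2≤deg = begin
    suc n                                      ≡⟨ cong₂ _+_ (Σℕ-indicator n i₀) (Σℕ-one n) ⟨
    Σℕ n (indicator i₀) + Σℕ n (λ _ → 1)       ≡⟨ Σℕ-distrib-+ n (indicator i₀) (λ _ → 1) ⟨
    Σℕ n (λ i → indicator i₀ i + 1)            ≤⟨ Σℕ-mono-≤ n pointwise ⟩
    degreeSum G                                ∎
    where
    open ℕₚ.≤-Reasoning
    pointwise : ∀ i → indicator i₀ i + 1 ≤ deg G i
    pointwise i with if-≟-cases i i₀ 1 0
    ... | inj₁ (refl , ind≡1) rewrite ind≡1 = 2≤deg
    ... | inj₂ (_    , ind≡0) rewrite ind≡0 = 1≤deg i

module _ {k} (G : Graph (suc (suc k))) (connected : Connected G) where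

  connected⇒1≤deg : ∀ i → 1 ≤ deg G i
  connected⇒1≤deg i with i Finₚ.≟ Fin.zero
  ... | yes refl = Adjacent⇒1≤deg G (proj₂ (walk-start G (connected i (Fin.suc Fin.zero)) λ ()))
  ... | no  i≢0  = Adjacent⇒1≤deg G (proj₂ (walk-start G (connected i Fin.zero) i≢0))

  tree⇒degreeSum<2n : Acyclic G → degreeSum G < 2 * suc (suc k)
  tree⇒degreeSum<2n acyclic with acyclic⇒degreeSum<2*nonIsolated G acyclic
  ... | inj₁ Σ≡0 = contradiction (subst (suc (suc k) ≤_) Σ≡0 (n≤degreeSum G connected⇒1≤deg)) λ ()
  ... | inj₂ Σ<  = subst (λ m → degreeSum G < 2 * m) (nonIsolated≡n G connected⇒1≤deg) Σ<

third-vertex : ∀ {k} {a b : Fin (3 + k)} → a ≢ b → ∃ λ z → z ≢ a × z ≢ b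
third-vertex {k} {a} {b} a≢b =
  Fin.punchIn a y , Finₚ.punchInᵢ≢i a y , λ z≡b → Finₚ.punchInᵢ≢i b′ Fin.zero
    (Finₚ.punchIn-injective a y b′ (trans z≡b (≡.sym (Finₚ.punchIn-punchOut a≢b))))
  where
  b′ : Fin (2 + k)
  b′ = Fin.punchOut a≢b
  y : Fin (2 + k)
  y = Fin.punchIn b′ Fin.zero

module _ {n} (G : Graph n) where

  deg≤1⇒walk-within-edge : (∀ i → deg G i ≤ 1) → ∀ {u w x y} → Adjacent G u w →
                           Walk G x y → x ≡ u ⊎ x ≡ w → y ≡ u ⊎ y ≡ w
  deg≤1⇒walk-within-edge deg≤1 u~w here               at-edge     = at-edge
  deg≤1⇒walk-within-edge deg≤1 u~w (step u~x walk) (inj₁ refl) =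
    deg≤1⇒walk-within-edge deg≤1 u~w walk (inj₂ (deg≤1⇒neighbour-unique G (deg≤1 _) u~w u~x))
  deg≤1⇒walk-within-edge deg≤1 u~w (step w~x walk) (inj₂ refl) =
    deg≤1⇒walk-within-edge deg≤1 u~w walk
      (inj₁ (deg≤1⇒neighbour-unique G (deg≤1 _) (Adjacent-sym G u~w) w~x))

connected⇒∃2≤deg : ∀ {k} (G : Graph (3 + k)) → Connected G → ∃ λ i → 2 ≤ deg G i
connected⇒∃2≤deg G connected with Finₚ.any? (λ i → 2 ℕ.≤? deg G i)
... | yes found = found
... | no  none  =
  let w , 0~w         = neighbour G Fin.zero (connected⇒1≤deg G connected Fin.zero)
      z , z≢0 , z≢w   = third-vertex (Adjacent⇒≢ G 0~w)
  in ⊥-elim ([ z≢0 , z≢w ]′ (deg≤1⇒walk-within-edge G deg≤1 0~w (connected Fin.zero z) (inj₁ refl)))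
  where
  deg≤1 : ∀ i → deg G i ≤ 1
  deg≤1 i = ℕₚ.≤-pred (ℕₚ.≰⇒> (λ 2≤deg → none (i , 2≤deg)))

pathAdj⇒ : ∀ {n} {a b : Fin n} → Adjacent (Pathₙ n) a b → suc (toℕ a) ≡ toℕ b ⊎ suc (toℕ b) ≡ toℕ a
pathAdj⇒ {a = a} {b} a~b with suc (toℕ a) ℕ.≟ toℕ b | suc (toℕ b) ℕ.≟ toℕ a
... | yes a+1≡b | _         = inj₁ a+1≡b
... | no  _     | yes b+1≡a = inj₂ b+1≡a
... | no  a+1≢b | no  b+1≢a = contradiction (trans (≡.sym a~b) a≁b) λ ()
  where
  a≁b : pathAdj a b ≡ false
  a≁b = cong₂ _∨_ (dec-false (suc (toℕ a) ℕ.≟ toℕ b) a+1≢b) (dec-false (suc (toℕ b) ℕ.≟ toℕ a) b+1≢a)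

pathAdj⇐ : ∀ {n} {a b : Fin n} → suc (toℕ a) ≡ toℕ b ⊎ suc (toℕ b) ≡ toℕ a → Adjacent (Pathₙ n) a b
pathAdj⇐ {a = a} {b} (inj₁ a+1≡b) =
  cong (_∨ does (suc (toℕ b) ℕ.≟ toℕ a)) (dec-true (suc (toℕ a) ℕ.≟ toℕ b) a+1≡b)
pathAdj⇐ {a = a} {b} (inj₂ b+1≡a) =
  trans (cong (does (suc (toℕ a) ℕ.≟ toℕ b) ∨_) (dec-true (suc (toℕ b) ℕ.≟ toℕ a) b+1≡a)) (Boolₚ.∨-zeroʳ _)

pathₙ-three-neighbours : ∀ {n} {i a b c : Fin n} →
                         Adjacent (Pathₙ n) i a → Adjacent (Pathₙ n) i b → Adjacent (Pathₙ n) i c →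
                         b ≢ a → c ≢ a → c ≢ b → ⊥
pathₙ-three-neighbours {i = i} i~a i~b i~c b≢a c≢a c≢b = sides (pathAdj⇒ i~a) (pathAdj⇒ i~b) (pathAdj⇒ i~c)
  where
  above : ∀ {x y} → suc (toℕ i) ≡ toℕ x → suc (toℕ i) ≡ toℕ y → x ≡ y
  above i+1≡x i+1≡y = Finₚ.toℕ-injective (trans (≡.sym i+1≡x) i+1≡y)
  below : ∀ {x y} → suc (toℕ x) ≡ toℕ i → suc (toℕ y) ≡ toℕ i → x ≡ y
  below x+1≡i y+1≡i = Finₚ.toℕ-injective (ℕₚ.suc-injective (trans x+1≡i (≡.sym y+1≡i)))
  sides : _ → _ → _ → ⊥
  sides (inj₁ a↑) (inj₁ b↑) _         = b≢a (above b↑ a↑)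
  sides (inj₂ a↓) (inj₂ b↓) _         = b≢a (below b↓ a↓)
  sides (inj₁ a↑) (inj₂ _)  (inj₁ c↑) = c≢a (above c↑ a↑)
  sides (inj₁ _)  (inj₂ b↓) (inj₂ c↓) = c≢b (below c↓ b↓)
  sides (inj₂ _)  (inj₁ b↑) (inj₁ c↑) = c≢b (above c↑ b↑)
  sides (inj₂ a↓) (inj₁ _)  (inj₂ c↓) = c≢a (below c↓ a↓)

pathₙ-deg≤2 : ∀ {n} (i : Fin n) → deg (Pathₙ n) i ≤ 2
pathₙ-deg≤2 {n} i with deg (Pathₙ n) i ℕ.≤? 2
... | yes deg≤2 = deg≤2
... | no  deg≰2 =
  let 3≤deg               = ℕₚ.≰⇒> deg≰2
      a , i~a             = neighbour (Pathₙ n) i (ℕₚ.≤-trans (s≤s z≤n) 3≤deg)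
      b , i~b , b≢a       = neighbour-≢ (Pathₙ n) i (ℕₚ.≤-trans (s≤s (s≤s z≤n)) 3≤deg) a
      c , i~c , c≢a , c≢b = neighbour-≢₂ (Pathₙ n) i 3≤deg a b
  in ⊥-elim (pathₙ-three-neighbours i~a i~b i~c b≢a c≢a c≢b)

≅⇒deg≡ : ∀ {n} {G H : Graph n} ((π , π-adj) : G ≅ H) → ∀ i → deg G i ≡ deg H (π ⟨$⟩ʳ i)
≅⇒deg≡ {n} {G} {H} (π , π-adj) i = begin
  deg G i                                              ≡⟨ Σℕ-cong n (λ j → cong b2n (≡.sym (π-adj i j))) ⟩
  Σℕ n (λ j → b2n (adj H (π ⟨$⟩ʳ i) (π ⟨$⟩ʳ j)))      ≡⟨ Σℕ≡sum n _ ⟩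
  ΣN.sum (λ j → b2n (adj H (π ⟨$⟩ʳ i) (π ⟨$⟩ʳ j)))    ≡⟨ ΣN.sum-permute (λ j → b2n (adj H (π ⟨$⟩ʳ i) j)) π ⟨
  ΣN.sum (λ j → b2n (adj H (π ⟨$⟩ʳ i) j))             ≡⟨ Σℕ≡sum n _ ⟨
  deg H (π ⟨$⟩ʳ i)                                     ∎
  where open ≡-Reasoning

≅Pathₙ⇒deg≤2 : ∀ {n} {G : Graph n} → G ≅ Pathₙ n → ∀ i → deg G i ≤ 2
≅Pathₙ⇒deg≤2 {n} {G} G≅P i =
  subst (_≤ 2) (≡.sym (≅⇒deg≡ {G = G} {H = Pathₙ n} G≅P i)) (pathₙ-deg≤2 (proj₁ G≅P ⟨$⟩ʳ i))

true-iff⇒≡ : ∀ {x y : Bool} → (x ≡ true → y ≡ true) → (y ≡ true → x ≡ true) → x ≡ y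
true-iff⇒≡ {false} {false} _   _   = refl
true-iff⇒≡ {false} {true}  _   y⇒x = y⇒x refl
true-iff⇒≡ {true}  {false} x⇒y _   = ≡.sym (x⇒y refl)
true-iff⇒≡ {true}  {true}  _   _   = refl

injective⇒surjective : ∀ {n} {f : Fin n → Fin n} → (∀ {i j} → f i ≡ f j → i ≡ j) → ∀ z → ∃ λ i → f i ≡ z
injective⇒surjective {suc m} {f} f-injective z with Finₚ.any? (λ i → f i Finₚ.≟ z)
... | yes found = found
... | no  missed = contradiction (Finₚ.injective⇒≤ punched-injective) ℕₚ.1+n≰n
  where
  punched : Fin (suc m) → Fin m
  punched i = Fin.punchOut {i = z} {j = f i} (λ z≡fi → missed (i , ≡.sym z≡fi))
  punched-injective : ∀ {i j} → punched i ≡ punched j → i ≡ j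
  punched-injective = f-injective ∘ Finₚ.punchOut-injective {i = z} _ _

module PathFromLeaf {m} (G : Graph (suc m)) (connected : Connected G)
  (deg≤2 : ∀ i → deg G i ≤ 2) {ℓ} (deg-ℓ≡1 : deg G ℓ ≡ 1) where

  private
    Other : Fin (suc m) → Fin (suc m) → Set
    Other p v = ∃ λ u → Adjacent G v u × u ≢ p

    other? : ∀ p v → Dec (Other p v)
    other? p v = Finₚ.any? (λ u → (adj G v u Boolₚ.≟ true) ×-dec ¬? (u Finₚ.≟ p))

    onward-via : ∀ p v → Adjacent G p v → Dec (Other p v) → ∃ (Adjacent G v)
    onward-via p v p~v (yes (u , v~u , _)) = u , v~u
    onward-via p v p~v (no  _)             = p , Adjacent-sym G p~v

    onward-via-≢ : ∀ p v (p~v : Adjacent G p v) other → 2 ≤ deg G v → proj₁ (onward-via p v p~v other) ≢ p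
    onward-via-≢ p v p~v (yes (_ , _ , u≢p)) _     = u≢p
    onward-via-≢ p v p~v (no  none)          2≤deg = ⊥-elim (none (neighbour-≢ G v 2≤deg p))

    onward : ∀ p v → Adjacent G p v → ∃ (Adjacent G v)
    onward p v p~v = onward-via p v p~v (other? p v)

    ℓ~ℓ₁ : ∃ (Adjacent G ℓ)
    ℓ~ℓ₁ = neighbour G ℓ (ℕₚ.≤-reflexive (≡.sym deg-ℓ≡1))

  open WalkFrom G onward (proj₂ ℓ~ℓ₁) renaming (walk to w; walk-adj to w-adj)

  w-nb : ∀ j → 2 ≤ deg G (w (suc j)) → w (suc (suc j)) ≢ w j
  w-nb j = onward-via-≢ (w j) (w (suc j)) (w-adj j) (other? (w j) (w (suc j)))

  InjectiveUpTo : ℕ → Set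
  InjectiveUpTo k = ∀ {a b} → a ≤ k → b ≤ k → w a ≡ w b → a ≡ b

  neighbours-start : ∀ {y} → Adjacent G (w 0) y → y ≡ w 1
  neighbours-start = deg≤1⇒neighbour-unique G (ℕₚ.≤-reflexive deg-ℓ≡1) (w-adj 0)

  neighbours-inner : ∀ {k} → InjectiveUpTo k → ∀ {j} → 2 + j ≤ k →
                     ∀ {y} → Adjacent G (w (suc j)) y → y ≡ w j ⊎ y ≡ w (2 + j)
  neighbours-inner inj {j} j+2≤k =
    deg≤2⇒neighbours G (deg≤2 _) (Adjacent-sym G (w-adj j)) (w-adj (suc j))
      λ wj≡wj+2 → ℕₚ.<⇒≢ (ℕₚ.m<n+m j (s≤s z≤n)) (inj (ℕₚ.≤-trans (ℕₚ.m≤n+m j 2) j+2≤k) j+2≤k wj≡wj+2)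

  no-chord : ∀ {K} → InjectiveUpTo K → ∀ {a b} → suc a < b → b ≤ K → ¬ Adjacent G (w a) (w b)
  no-chord inj {zero} {b} 1<b b≤K w0~wb =
    ℕₚ.<⇒≢ 1<b (inj (ℕₚ.≤-trans (ℕₚ.<⇒≤ 1<b) b≤K) b≤K (≡.sym (neighbours-start w0~wb)))
  no-chord inj {suc a} {b} a+2<b b≤K wa+1~wb
    with neighbours-inner inj (ℕₚ.≤-trans (ℕₚ.<⇒≤ a+2<b) b≤K) wa+1~wb
  ... | inj₁ wb≡wa   = ℕₚ.<⇒≢ a<b (inj (ℕₚ.≤-trans (ℕₚ.<⇒≤ a<b) b≤K) b≤K (≡.sym wb≡wa))
    where
    a<b : a < b
    a<b = ℕₚ.<-trans (ℕₚ.n<1+n a) (ℕₚ.<-trans (ℕₚ.n<1+n (suc a)) a+2<b)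
  ... | inj₂ wb≡wa+2 = ℕₚ.<⇒≢ a+2<b (inj (ℕₚ.<⇒≤ (ℕₚ.<-≤-trans a+2<b b≤K)) b≤K (≡.sym wb≡wa+2))

  -- If the walk meets a vertex of degree 1 at step j + 1, the vertices visited so far are closed
  -- under adjacency, hence by connectivity they are all the vertices.
  stuck : ∀ {j} → InjectiveUpTo (suc j) → deg G (w (suc j)) ≤ 1 → suc m ≤ 2 + j
  stuck {j} inj deg≤1 = Finₚ.injective⇒≤ index-injective
    where
    Visited : Fin (suc m) → Set
    Visited x = ∃ λ a → a ≤ suc j × w a ≡ x
    closed : ∀ {x y} → Visited x → Adjacent G x y → Visited y
    closed (zero , _ , refl) x~y = 1 , s≤s z≤n , ≡.sym (neighbours-start x~y)
    closed (suc a , a+1≤j+1 , refl) x~y with ℕₚ.m≤n⇒m<n∨m≡n a+1≤j+1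
    ... | inj₂ refl = a , ℕₚ.n≤1+n a , ≡.sym (deg≤1⇒neighbour-unique G deg≤1 (Adjacent-sym G (w-adj a)) x~y)
    ... | inj₁ a+2≤j+1 with neighbours-inner inj a+2≤j+1 x~y
    ...   | inj₁ y≡wa   = a , ℕₚ.≤-trans (ℕₚ.n≤1+n a) a+1≤j+1 , ≡.sym y≡wa
    ...   | inj₂ y≡wa+2 = 2 + a , a+2≤j+1 , ≡.sym y≡wa+2
    reach : ∀ {x y} → Walk G x y → Visited x → Visited y
    reach here            visited = visited
    reach (step x~x′ walk) visited = reach walk (closed visited x~x′)
    visit : ∀ z → Visited z
    visit z = reach (connected (w 0) z) (0 , z≤n , refl)
    index : Fin (suc m) → Fin (2 + j)
    index z = Fin.fromℕ< (s≤s (proj₁ (proj₂ (visit z))))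
    index-injective : ∀ {z z′} → index z ≡ index z′ → z ≡ z′
    index-injective {z} {z′} eq = begin
      z                        ≡⟨ proj₂ (proj₂ (visit z)) ⟨
      w (proj₁ (visit z))      ≡⟨ cong w (Finₚ.fromℕ<-injective _ _ _ _ eq) ⟩
      w (proj₁ (visit z′))     ≡⟨ proj₂ (proj₂ (visit z′)) ⟩
      z′                       ∎
      where open ≡-Reasoning

  fresh : ∀ {k} → suc k < suc m → InjectiveUpTo k → ∀ {a} → a ≤ k → w a ≢ w (suc k)
  fresh {zero}  _     _   {zero} _ = Adjacent⇒≢ G (w-adj 0)
  fresh {suc j} k+1<N inj {a} a≤j+1 wa≡wj+2 with ℕₚ.m≤n⇒m<n∨m≡n a≤j+1
  ... | inj₂ refl = Adjacent⇒≢ G (w-adj (suc j)) wa≡wj+2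
  ... | inj₁ (s≤s a≤j) with ℕₚ.m≤n⇒m<n∨m≡n a≤j
  ...   | inj₂ refl = w-nb j 2≤deg (≡.sym wa≡wj+2)
    where
    2≤deg : 2 ≤ deg G (w (suc j))
    2≤deg = ℕₚ.≰⇒> (λ deg≤1 → ℕₚ.<⇒≱ k+1<N (stuck inj deg≤1))
  ...   | inj₁ a<j = no-chord inj (s≤s a<j) ℕₚ.≤-refl wa~wj+1
    where
    wa~wj+1 : Adjacent G (w a) (w (suc j))
    wa~wj+1 = subst (λ x → Adjacent G x (w (suc j))) (≡.sym wa≡wj+2) (Adjacent-sym G (w-adj (suc j)))

  extend : ∀ {k} → suc k < suc m → InjectiveUpTo k → InjectiveUpTo (suc k)
  extend k+1<N inj a≤k+1 b≤k+1 wa≡wb with ℕₚ.m≤n⇒m<n∨m≡n a≤k+1 | ℕₚ.m≤n⇒m<n∨m≡n b≤k+1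
  ... | inj₁ (s≤s a≤k) | inj₁ (s≤s b≤k) = inj a≤k b≤k wa≡wb
  ... | inj₁ (s≤s a≤k) | inj₂ refl      = ⊥-elim (fresh k+1<N inj a≤k wa≡wb)
  ... | inj₂ refl      | inj₁ (s≤s b≤k) = ⊥-elim (fresh k+1<N inj b≤k (≡.sym wa≡wb))
  ... | inj₂ refl      | inj₂ refl      = refl

  injectiveUpTo : ∀ {k} → k ≤ m → InjectiveUpTo k
  injectiveUpTo {zero}  _     z≤n z≤n _ = refl
  injectiveUpTo {suc k} k+1≤m = extend (s≤s k+1≤m) (injectiveUpTo (ℕₚ.≤-trans (ℕₚ.n≤1+n k) k+1≤m))

  adjacent⇒consecutive : ∀ {a b} → a ≤ m → b ≤ m → Adjacent G (w a) (w b) → suc a ≡ b ⊎ suc b ≡ a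
  adjacent⇒consecutive {a} {b} a≤m b≤m wa~wb with ℕₚ.<-cmp a b
  ... | tri≈ _ refl _ = contradiction refl (Adjacent⇒≢ G wa~wb)
  ... | tri< a<b _ _ with ℕₚ.m≤n⇒m<n∨m≡n a<b
  ...   | inj₂ a+1≡b = inj₁ a+1≡b
  ...   | inj₁ a+1<b = contradiction wa~wb (no-chord (injectiveUpTo ℕₚ.≤-refl) a+1<b b≤m)
  adjacent⇒consecutive {a} {b} a≤m b≤m wa~wb | tri> _ _ b<a with ℕₚ.m≤n⇒m<n∨m≡n b<a
  ...   | inj₂ b+1≡a = inj₂ b+1≡a
  ...   | inj₁ b+1<a = contradiction (Adjacent-sym G wa~wb) (no-chord (injectiveUpTo ℕₚ.≤-refl) b+1<a a≤m)

  vertexAt : Fin (suc m) → Fin (suc m)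
  vertexAt i = w (toℕ i)

  vertexAt-injective : ∀ {i j} → vertexAt i ≡ vertexAt j → i ≡ j
  vertexAt-injective {i} {j} eq =
    Finₚ.toℕ-injective (injectiveUpTo ℕₚ.≤-refl (Finₚ.toℕ≤pred[n] i) (Finₚ.toℕ≤pred[n] j) eq)

  position : Fin (suc m) → Fin (suc m)
  position z = proj₁ (injective⇒surjective vertexAt-injective z)

  vertexAt-position : ∀ z → vertexAt (position z) ≡ z
  vertexAt-position z = proj₂ (injective⇒surjective vertexAt-injective z)

  adj-vertexAt : ∀ a b → adj G (vertexAt a) (vertexAt b) ≡ pathAdj a b
  adj-vertexAt a b = true-iff⇒≡
    (λ wa~wb → pathAdj⇐ (adjacent⇒consecutive (Finₚ.toℕ≤pred[n] a) (Finₚ.toℕ≤pred[n] b) wa~wb))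
    (λ a~b → walk-step (pathAdj⇒ a~b))
    where
    walk-step : suc (toℕ a) ≡ toℕ b ⊎ suc (toℕ b) ≡ toℕ a → Adjacent G (vertexAt a) (vertexAt b)
    walk-step (inj₁ a+1≡b) = subst (λ k → Adjacent G (w (toℕ a)) (w k)) a+1≡b (w-adj (toℕ a))
    walk-step (inj₂ b+1≡a) =
      Adjacent-sym G (subst (λ k → Adjacent G (w (toℕ b)) (w k)) b+1≡a (w-adj (toℕ b)))

  ≅Pathₙ : G ≅ Pathₙ (suc m)
  ≅Pathₙ = π , λ i j → trans (≡.sym (adj-vertexAt (position i) (position j)))
                             (cong₂ (adj G) (vertexAt-position i) (vertexAt-position j))
    where
    π : Permutation′ (suc m)
    π = permutation position vertexAt (λ i → vertexAt-injective (vertexAt-position (vertexAt i))) vertexAt-position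

tree⇒deg≤2⇔≅Pathₙ : ∀ {k} (T : Graph (suc (suc k))) → IsTree T →
                     (∀ i → deg T i ≤ 2) ⇔ (T ≅ Pathₙ (suc (suc k)))
tree⇒deg≤2⇔≅Pathₙ T (connected , acyclic) =
  mk⇔ (λ deg≤2 → PathFromLeaf.≅Pathₙ T connected deg≤2 (proj₂ leaf)) (≅Pathₙ⇒deg≤2 {G = T})
  where
  leaf = acyclic⇒leaf T acyclic (ℕₚ.≤-trans (s≤s z≤n) (n≤degreeSum T (connected⇒1≤deg T connected)))

-- Rational arithmetic

toℚᵘ-/ : ∀ i k → toℚᵘ (i ℚ./ suc k) ≃ᵘ mkℚᵘ i k
toℚᵘ-/ i k = ℚₚ.toℚᵘ-fromℚᵘ (mkℚᵘ i k)

ℕ→ℚ-homo-+ : ∀ a b → ℕ→ℚ (a + b) ≡ ℕ→ℚ a ℚ.+ ℕ→ℚ b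
ℕ→ℚ-homo-+ a b = ℚₚ.toℚᵘ-injective (begin
  toℚᵘ (ℕ→ℚ (a + b))                 ≈⟨ toℚᵘ-/ (ℤ.+ (a + b)) 0 ⟩
  mkℚᵘ (ℤ.+ (a + b)) 0               ≈⟨ *≡* (cong (ℤ._* ℤ.+ 1) (trans (ℤₚ.pos-+ a b) (≡.sym
                                          (cong₂ ℤ._+_ (ℤₚ.*-identityʳ (ℤ.+ a)) (ℤₚ.*-identityʳ (ℤ.+ b)))))) ⟩
  mkℚᵘ (ℤ.+ a) 0 ℚᵘ.+ mkℚᵘ (ℤ.+ b) 0 ≈⟨ ℚᵘₚ.+-cong (toℚᵘ-/ (ℤ.+ a) 0) (toℚᵘ-/ (ℤ.+ b) 0) ⟨
  toℚᵘ (ℕ→ℚ a) ℚᵘ.+ toℚᵘ (ℕ→ℚ b)     ≈⟨ ℚₚ.toℚᵘ-homo-+ (ℕ→ℚ a) (ℕ→ℚ b) ⟨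
  toℚᵘ (ℕ→ℚ a ℚ.+ ℕ→ℚ b)             ∎)
  where open ℚᵘₚ.≃-Reasoning

ℕ→ℚ-homo-* : ∀ a b → ℕ→ℚ (a * b) ≡ ℕ→ℚ a ℚ.* ℕ→ℚ b
ℕ→ℚ-homo-* a b = ℚₚ.toℚᵘ-injective (begin
  toℚᵘ (ℕ→ℚ (a * b))                 ≈⟨ toℚᵘ-/ (ℤ.+ (a * b)) 0 ⟩
  mkℚᵘ (ℤ.+ (a * b)) 0               ≈⟨ *≡* (cong (ℤ._* ℤ.+ 1) (ℤₚ.pos-* a b)) ⟩
  mkℚᵘ (ℤ.+ a) 0 ℚᵘ.* mkℚᵘ (ℤ.+ b) 0 ≈⟨ ℚᵘₚ.*-cong (toℚᵘ-/ (ℤ.+ a) 0) (toℚᵘ-/ (ℤ.+ b) 0) ⟨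
  toℚᵘ (ℕ→ℚ a) ℚᵘ.* toℚᵘ (ℕ→ℚ b)     ≈⟨ ℚₚ.toℚᵘ-homo-* (ℕ→ℚ a) (ℕ→ℚ b) ⟨
  toℚᵘ (ℕ→ℚ a ℚ.* ℕ→ℚ b)             ∎)
  where open ℚᵘₚ.≃-Reasoning

ℕ→ℚ-*-/-cancel : ∀ k l → ℕ→ℚ (suc l) ℚ.* (ℤ.+ k ℚ./ suc l) ≡ ℕ→ℚ k
ℕ→ℚ-*-/-cancel k l = ℚₚ.toℚᵘ-injective (begin
  toℚᵘ (ℕ→ℚ (suc l) ℚ.* (ℤ.+ k ℚ./ suc l))       ≈⟨ ℚₚ.toℚᵘ-homo-* (ℕ→ℚ (suc l)) (ℤ.+ k ℚ./ suc l) ⟩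
  toℚᵘ (ℕ→ℚ (suc l)) ℚᵘ.* toℚᵘ (ℤ.+ k ℚ./ suc l) ≈⟨ ℚᵘₚ.*-cong (toℚᵘ-/ (ℤ.+ suc l) 0) (toℚᵘ-/ (ℤ.+ k) l) ⟩
  mkℚᵘ (ℤ.+ suc l) 0 ℚᵘ.* mkℚᵘ (ℤ.+ k) l         ≈⟨ *≡* cross ⟩
  mkℚᵘ (ℤ.+ k) 0                                 ≈⟨ toℚᵘ-/ (ℤ.+ k) 0 ⟨
  toℚᵘ (ℕ→ℚ k)                                   ∎)
  where
  open ℚᵘₚ.≃-Reasoning
  cross : (ℤ.+ suc l ℤ.* ℤ.+ k) ℤ.* ℤ.+ 1 ≡ ℤ.+ k ℤ.* ℤ.+ suc (l + 0)
  cross = trans (ℤₚ.*-identityʳ _) (trans (ℤₚ.*-comm (ℤ.+ suc l) (ℤ.+ k))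
                (cong (λ j → ℤ.+ k ℤ.* ℤ.+ suc j) (≡.sym (ℕₚ.+-identityʳ l))))

ℕ→ℚ-nonNeg : ∀ k → NonNegative (ℕ→ℚ k)
ℕ→ℚ-nonNeg k = ℚₚ.normalize-nonNeg k 1

ℕ→ℚ-pos : ∀ k → Positive (ℕ→ℚ (suc k))
ℕ→ℚ-pos k = ℚₚ.normalize-pos (suc k) 1

ℕ→ℚ-mono-≤ : ∀ {a b} → a ≤ b → ℕ→ℚ a ℚ.≤ ℕ→ℚ b
ℕ→ℚ-mono-≤ {a} a≤b with ℕₚ.m≤n⇒∃[o]m+o≡n a≤b
... | k , refl = begin
  ℕ→ℚ a               ≡⟨ ℚₚ.+-identityʳ (ℕ→ℚ a) ⟨
  ℕ→ℚ a ℚ.+ 0ℚ        ≤⟨ ℚₚ.+-monoʳ-≤ (ℕ→ℚ a) (ℚₚ.nonNegative⁻¹ (ℕ→ℚ k) {{ℕ→ℚ-nonNeg k}}) ⟩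
  ℕ→ℚ a ℚ.+ ℕ→ℚ k     ≡⟨ ℕ→ℚ-homo-+ a k ⟨
  ℕ→ℚ (a + k)         ∎
  where open ℚₚ.≤-Reasoning

ℕ→ℚ-mono-< : ∀ {a b} → a < b → ℕ→ℚ a ℚ.< ℕ→ℚ b
ℕ→ℚ-mono-< {a} a<b with ℕₚ.m≤n⇒∃[o]m+o≡n a<b
... | k , refl = begin-strict
  ℕ→ℚ a                    ≡⟨ ℚₚ.+-identityʳ (ℕ→ℚ a) ⟨
  ℕ→ℚ a ℚ.+ 0ℚ             <⟨ ℚₚ.+-monoʳ-< (ℕ→ℚ a) (ℚₚ.positive⁻¹ (ℕ→ℚ (suc k)) {{ℕ→ℚ-pos k}}) ⟩
  ℕ→ℚ a ℚ.+ ℕ→ℚ (suc k)    ≡⟨ ℕ→ℚ-homo-+ a (suc k) ⟨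
  ℕ→ℚ (a + suc k)          ≡⟨ cong ℕ→ℚ (ℕₚ.+-suc a k) ⟩
  ℕ→ℚ (suc a + k)          ∎
  where open ℚₚ.≤-Reasoning

2ℚ 3ℚ : ℚ
2ℚ = ℕ→ℚ 2
3ℚ = ℕ→ℚ 3

p<q⇒0<q-p : ∀ {p q} → p ℚ.< q → 0ℚ ℚ.< q ℚ.- p
p<q⇒0<q-p {p} {q} p<q = subst (ℚ._< q ℚ.- p) (ℚₚ.+-inverseʳ p) (ℚₚ.+-monoˡ-< (ℚ.- p) p<q)

p≤q⇒0≤q-p : ∀ {p q} → p ℚ.≤ q → 0ℚ ℚ.≤ q ℚ.- p
p≤q⇒0≤q-p {p} {q} p≤q = subst (ℚ._≤ q ℚ.- p) (ℚₚ.+-inverseʳ p) (ℚₚ.+-monoˡ-≤ (ℚ.- p) p≤q)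

0≤q-p⇒p≤q : ∀ {p q} → 0ℚ ℚ.≤ q ℚ.- p → p ℚ.≤ q
0≤q-p⇒p≤q {p} {q} 0≤q-p = subst₂ ℚ._≤_ (ℚₚ.+-identityʳ p) (solve 2 (λ p q → p :+ (q :- p) := q) refl p q)
                                  (ℚₚ.+-monoʳ-≤ p 0≤q-p)
  where open +-*-Solver

q-p≡0⇒q≡p : ∀ {p q} → q ℚ.- p ≡ 0ℚ → q ≡ p
q-p≡0⇒q≡p {p} {q} q-p≡0 = begin
  q                    ≡⟨ solve 2 (λ p q → q := p :+ (q :- p)) refl p q ⟩
  p ℚ.+ (q ℚ.- p)      ≡⟨ cong (p ℚ.+_) q-p≡0 ⟩
  p ℚ.+ 0ℚ             ≡⟨ ℚₚ.+-identityʳ p ⟩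
  p                    ∎
  where
  open ≡-Reasoning
  open +-*-Solver

p<0⇒∣p∣≡-p : ∀ {p} → p ℚ.< 0ℚ → ℚ.∣ p ∣ ≡ ℚ.- p
p<0⇒∣p∣≡-p {p} p<0 = trans (≡.sym (ℚₚ.∣-p∣≡∣p∣ p)) (ℚₚ.0≤p⇒∣p∣≡p (ℚₚ.<⇒≤ (ℚₚ.neg-antimono-< p<0)))

÷-*-cancel : ∀ p q .{{_ : NonZero q}} → (p ℚ.÷ q) ℚ.* q ≡ p
÷-*-cancel p q = trans (ℚₚ.*-assoc p (ℚ.1/ q) q) (trans (cong (p ℚ.*_) (ℚₚ.*-inverseˡ q)) (ℚₚ.*-identityʳ p))

*-cancelʳ-≡-pos : ∀ r .{{_ : Positive r}} {p q} → p ℚ.* r ≡ q ℚ.* r → p ≡ q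
*-cancelʳ-≡-pos r pr≡qr = ℚₚ.≤-antisym (ℚₚ.*-cancelʳ-≤-pos r (ℚₚ.≤-reflexive pr≡qr))
                                       (ℚₚ.*-cancelʳ-≤-pos r (ℚₚ.≤-reflexive (≡.sym pr≡qr)))

module ΣQ = SemiringSum (CommutativeRing.semiring ℚₚ.+-*-commutativeRing)

Σℚ≡sum : ∀ n (f : Fin n → ℚ) → Σℚ n f ≡ ΣQ.sum f
Σℚ≡sum zero    f = refl
Σℚ≡sum (suc n) f = cong (f Fin.zero ℚ.+_) (Σℚ≡sum n (f ∘ Fin.suc))

Σℚ-cong : ∀ n {f g : Fin n → ℚ} → (∀ i → f i ≡ g i) → Σℚ n f ≡ Σℚ n g
Σℚ-cong zero    f≗g = refl
Σℚ-cong (suc n) f≗g = cong₂ ℚ._+_ (f≗g Fin.zero) (Σℚ-cong n (f≗g ∘ Fin.suc))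

Σℚ-distrib-+ : ∀ n (f g : Fin n → ℚ) → Σℚ n (λ i → f i ℚ.+ g i) ≡ Σℚ n f ℚ.+ Σℚ n g
Σℚ-distrib-+ n f g
  rewrite Σℚ≡sum n (λ i → f i ℚ.+ g i) | Σℚ≡sum n f | Σℚ≡sum n g = ΣQ.∑-distrib-+ f g

*-distribˡ-Σℚ : ∀ n c (f : Fin n → ℚ) → c ℚ.* Σℚ n f ≡ Σℚ n (λ i → c ℚ.* f i)
*-distribˡ-Σℚ n c f rewrite Σℚ≡sum n (λ i → c ℚ.* f i) | Σℚ≡sum n f = ΣQ.*-distribˡ-sum c f

neg-distrib-Σℚ : ∀ n (f : Fin n → ℚ) → ℚ.- Σℚ n f ≡ Σℚ n (λ i → ℚ.- f i)
neg-distrib-Σℚ zero    f = refl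
neg-distrib-Σℚ (suc n) f =
  trans (ℚₚ.neg-distrib-+ (f Fin.zero) (Σℚ n (f ∘ Fin.suc)))
        (cong (ℚ.- f Fin.zero ℚ.+_) (neg-distrib-Σℚ n (f ∘ Fin.suc)))

Σℚ-const : ∀ n c → Σℚ n (λ _ → c) ≡ ℕ→ℚ n ℚ.* c
Σℚ-const zero    c = ≡.sym (ℚₚ.*-zeroˡ c)
Σℚ-const (suc n) c = begin
  c ℚ.+ Σℚ n (λ _ → c)        ≡⟨ cong (c ℚ.+_) (Σℚ-const n c) ⟩
  c ℚ.+ ℕ→ℚ n ℚ.* c           ≡⟨ solve 2 (λ c N → c :+ N :* c := (con 1ℚ :+ N) :* c) refl c (ℕ→ℚ n) ⟩
  (1ℚ ℚ.+ ℕ→ℚ n) ℚ.* c        ≡⟨ cong (ℚ._* c) (ℕ→ℚ-homo-+ 1 n) ⟨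
  ℕ→ℚ (suc n) ℚ.* c           ∎
  where
  open ≡-Reasoning
  open +-*-Solver

ℕ→ℚ-homo-Σ : ∀ n (f : Fin n → ℕ) → ℕ→ℚ (Σℕ n f) ≡ Σℚ n (ℕ→ℚ ∘ f)
ℕ→ℚ-homo-Σ zero    f = refl
ℕ→ℚ-homo-Σ (suc n) f =
  trans (ℕ→ℚ-homo-+ (f Fin.zero) _) (cong (ℕ→ℚ (f Fin.zero) ℚ.+_) (ℕ→ℚ-homo-Σ n (f ∘ Fin.suc)))

Σℚ-nonNeg : ∀ n {f : Fin n → ℚ} → (∀ i → 0ℚ ℚ.≤ f i) → 0ℚ ℚ.≤ Σℚ n f
Σℚ-nonNeg zero    _      = ℚₚ.≤-refl
Σℚ-nonNeg (suc n) 0≤f = ℚₚ.+-mono-≤ (0≤f Fin.zero) (Σℚ-nonNeg n (0≤f ∘ Fin.suc))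

Σℚ-pos : ∀ n {f : Fin n → ℚ} → (∀ i → 0ℚ ℚ.≤ f i) → ∀ i₀ → 0ℚ ℚ.< f i₀ → 0ℚ ℚ.< Σℚ n f
Σℚ-pos (suc n) 0≤f Fin.zero    0<f₀ = ℚₚ.+-mono-<-≤ 0<f₀ (Σℚ-nonNeg n (0≤f ∘ Fin.suc))
Σℚ-pos (suc n) 0≤f (Fin.suc i) 0<fᵢ = ℚₚ.+-mono-≤-< (0≤f Fin.zero) (Σℚ-pos n (0≤f ∘ Fin.suc) i 0<fᵢ)

nonNeg+nonNeg≡0 : ∀ {p q} → 0ℚ ℚ.≤ p → 0ℚ ℚ.≤ q → p ℚ.+ q ≡ 0ℚ → p ≡ 0ℚ × q ≡ 0ℚ
nonNeg+nonNeg≡0 {p} {q} 0≤p 0≤q p+q≡0 =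
  ℚₚ.≤-antisym (subst (p ℚ.≤_) p+q≡0 p≤p+q) 0≤p , ℚₚ.≤-antisym (subst (q ℚ.≤_) p+q≡0 q≤p+q) 0≤q
  where
  p≤p+q : p ℚ.≤ p ℚ.+ q
  p≤p+q = subst (ℚ._≤ p ℚ.+ q) (ℚₚ.+-identityʳ p) (ℚₚ.+-monoʳ-≤ p 0≤q)
  q≤p+q : q ℚ.≤ p ℚ.+ q
  q≤p+q = subst (ℚ._≤ p ℚ.+ q) (ℚₚ.+-identityˡ q) (ℚₚ.+-monoˡ-≤ q 0≤p)

Σℚ≡0⇒≡0 : ∀ n {f : Fin n → ℚ} → (∀ i → 0ℚ ℚ.≤ f i) → Σℚ n f ≡ 0ℚ → ∀ i → f i ≡ 0ℚ
Σℚ≡0⇒≡0 (suc n) 0≤f Σ≡0 Fin.zero    = proj₁ (nonNeg+nonNeg≡0 (0≤f Fin.zero) (Σℚ-nonNeg n (0≤f ∘ Fin.suc)) Σ≡0)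
Σℚ≡0⇒≡0 (suc n) 0≤f Σ≡0 (Fin.suc i) = Σℚ≡0⇒≡0 n (0≤f ∘ Fin.suc) tail≡0 i
  where
  tail≡0 : Σℚ n (λ i → _) ≡ 0ℚ
  tail≡0 = proj₂ (nonNeg+nonNeg≡0 (0≤f Fin.zero) (Σℚ-nonNeg n (0≤f ∘ Fin.suc)) Σ≡0)

inv≡2*inv[2*] : ∀ k → inv (suc k) ≡ 2ℚ ℚ.* inv (2 * suc k)
inv≡2*inv[2*] k = begin
  ν                             ≡⟨ ℚₚ.*-identityʳ ν ⟨
  ν ℚ.* 1ℚ                      ≡⟨ cong (ν ℚ.*_) (ℕ→ℚ-*-/-cancel 1 (ℕ.pred (2 * suc k))) ⟨
  ν ℚ.* (ℕ→ℚ (2 * suc k) ℚ.* h) ≡⟨ cong (λ q → ν ℚ.* (q ℚ.* h)) (ℕ→ℚ-homo-* 2 (suc k)) ⟩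
  ν ℚ.* (2ℚ ℚ.* N ℚ.* h)        ≡⟨ solve 3 (λ ν N h → ν :* (con 2ℚ :* N :* h) := N :* ν :* (con 2ℚ :* h)) refl ν N h ⟩
  N ℚ.* ν ℚ.* (2ℚ ℚ.* h)        ≡⟨ cong (ℚ._* (2ℚ ℚ.* h)) (ℕ→ℚ-*-/-cancel 1 k) ⟩
  1ℚ ℚ.* (2ℚ ℚ.* h)             ≡⟨ ℚₚ.*-identityˡ (2ℚ ℚ.* h) ⟩
  2ℚ ℚ.* h                      ∎
  where
  open ≡-Reasoning
  open +-*-Solver
  N ν h : ℚ
  N = ℕ→ℚ (suc k)
  ν = inv (suc k)
  h = inv (2 * suc k)

-- Degree deviations

avgDeg-mean : ∀ {k} (G : Graph (suc k)) → ℕ→ℚ (suc k) ℚ.* avgDeg G ≡ ℕ→ℚ (degreeSum G)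
avgDeg-mean {k} G = trans (ℕ→ℚ-*-/-cancel (2 * edges G) k) (cong ℕ→ℚ (≡.sym (handshake G)))

module DegreeDeviation {n} (d : Fin n → ℕ) (1≤d : ∀ i → 1 ≤ d i)
  (n<Σd : n < Σℕ n d) (Σd<2n : Σℕ n d < 2 * n)
  (a : ℚ) (mean : ℕ→ℚ n ℚ.* a ≡ ℕ→ℚ (Σℕ n d)) where

  private
    N : ℚ
    N = ℕ→ℚ n
    instance
      N-nonNeg : NonNegative N
      N-nonNeg = ℕ→ℚ-nonNeg n

  1<a : 1ℚ ℚ.< a
  1<a = ℚₚ.*-cancelˡ-<-nonNeg N (begin-strict
    N ℚ.* 1ℚ              ≡⟨ ℚₚ.*-identityʳ N ⟩
    N                     <⟨ ℕ→ℚ-mono-< n<Σd ⟩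
    ℕ→ℚ (Σℕ n d)          ≡⟨ mean ⟨
    N ℚ.* a               ∎)
    where open ℚₚ.≤-Reasoning

  a<2 : a ℚ.< 2ℚ
  a<2 = ℚₚ.*-cancelˡ-<-nonNeg N (begin-strict
    N ℚ.* a               ≡⟨ mean ⟩
    ℕ→ℚ (Σℕ n d)          <⟨ ℕ→ℚ-mono-< Σd<2n ⟩
    ℕ→ℚ (2 * n)           ≡⟨ trans (cong ℕ→ℚ (ℕₚ.*-comm 2 n)) (ℕ→ℚ-homo-* n 2) ⟩
    N ℚ.* 2ℚ              ∎)
    where open ℚₚ.≤-Reasoning

  x : Fin n → ℚ
  x i = ℕ→ℚ (d i) ℚ.- a

  c : ℚ
  c = 3ℚ ℚ.- 2ℚ ℚ.* a

  excess : ℚ → ℚ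
  excess t = 2ℚ ℚ.* (t ℚ.* t) ℚ.- ℚ.∣ t ∣ ℚ.- c ℚ.* t

  leaf⊎branch : ∀ i → d i ≡ 1 ⊎ 2 ≤ d i
  leaf⊎branch i with ℕₚ.m≤n⇒m<n∨m≡n (1≤d i)
  ... | inj₁ 2≤dᵢ = inj₂ 2≤dᵢ
  ... | inj₂ 1≡dᵢ = inj₁ (≡.sym 1≡dᵢ)

  x<0 : ∀ {i} → d i ≡ 1 → x i ℚ.< 0ℚ
  x<0 {i} dᵢ≡1 = subst (ℚ._< 0ℚ) (cong (λ k → ℕ→ℚ k ℚ.- a) (≡.sym dᵢ≡1))
                   (subst (1ℚ ℚ.- a ℚ.<_) (ℚₚ.+-inverseʳ a) (ℚₚ.+-monoˡ-< (ℚ.- a) 1<a))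

  0<x : ∀ {i} → 2 ≤ d i → 0ℚ ℚ.< x i
  0<x 2≤dᵢ = p<q⇒0<q-p (ℚₚ.<-≤-trans a<2 (ℕ→ℚ-mono-≤ 2≤dᵢ))

  excess-leaf : ∀ {i} → d i ≡ 1 → excess (x i) ≡ 0ℚ
  excess-leaf {i} dᵢ≡1 = begin
    2ℚ ℚ.* (x i ℚ.* x i) ℚ.- ℚ.∣ x i ∣ ℚ.- c ℚ.* x i
      ≡⟨ cong (λ s → 2ℚ ℚ.* (x i ℚ.* x i) ℚ.- s ℚ.- c ℚ.* x i) (p<0⇒∣p∣≡-p (x<0 dᵢ≡1)) ⟩
    2ℚ ℚ.* (x i ℚ.* x i) ℚ.- ℚ.- x i ℚ.- c ℚ.* x i
      ≡⟨ solve 2 (λ δ a → let t = δ :- a in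
                   con 2ℚ :* (t :* t) :- (:- t) :- (con 3ℚ :- con 2ℚ :* a) :* t := con 2ℚ :* t :* (δ :- con 1ℚ))
               refl (ℕ→ℚ (d i)) a ⟩
    2ℚ ℚ.* x i ℚ.* (ℕ→ℚ (d i) ℚ.- 1ℚ)
      ≡⟨ cong (λ k → 2ℚ ℚ.* x i ℚ.* (ℕ→ℚ k ℚ.- 1ℚ)) dᵢ≡1 ⟩
    2ℚ ℚ.* x i ℚ.* 0ℚ
      ≡⟨ ℚₚ.*-zeroʳ (2ℚ ℚ.* x i) ⟩
    0ℚ ∎
    where
    open ≡-Reasoning
    open +-*-Solver

  excess-branch : ∀ {i} → 2 ≤ d i → excess (x i) ≡ 2ℚ ℚ.* x i ℚ.* (ℕ→ℚ (d i) ℚ.- 2ℚ)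
  excess-branch {i} 2≤dᵢ = begin
    2ℚ ℚ.* (x i ℚ.* x i) ℚ.- ℚ.∣ x i ∣ ℚ.- c ℚ.* x i
      ≡⟨ cong (λ s → 2ℚ ℚ.* (x i ℚ.* x i) ℚ.- s ℚ.- c ℚ.* x i) (ℚₚ.0≤p⇒∣p∣≡p (ℚₚ.<⇒≤ (0<x 2≤dᵢ))) ⟩
    2ℚ ℚ.* (x i ℚ.* x i) ℚ.- x i ℚ.- c ℚ.* x i
      ≡⟨ solve 2 (λ δ a → let t = δ :- a in
                   con 2ℚ :* (t :* t) :- t :- (con 3ℚ :- con 2ℚ :* a) :* t := con 2ℚ :* t :* (δ :- con 2ℚ))
               refl (ℕ→ℚ (d i)) a ⟩
    2ℚ ℚ.* x i ℚ.* (ℕ→ℚ (d i) ℚ.- 2ℚ) ∎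
    where
    open ≡-Reasoning
    open +-*-Solver

  2x-pos : ∀ {i} → 2 ≤ d i → Positive (2ℚ ℚ.* x i)
  2x-pos {i} 2≤dᵢ = ℚₚ.pos*pos⇒pos 2ℚ {{ℕ→ℚ-pos 1}} (x i) {{positive (0<x 2≤dᵢ)}}

  0≤excess : ∀ i → 0ℚ ℚ.≤ excess (x i)
  0≤excess i with leaf⊎branch i
  ... | inj₁ dᵢ≡1 = ℚₚ.≤-reflexive (≡.sym (excess-leaf dᵢ≡1))
  ... | inj₂ 2≤dᵢ = subst (0ℚ ℚ.≤_) (≡.sym (excess-branch 2≤dᵢ)) (ℚₚ.nonNegative⁻¹ _ {{product-nonNeg}})
    where
    product-nonNeg : NonNegative (2ℚ ℚ.* x i ℚ.* (ℕ→ℚ (d i) ℚ.- 2ℚ))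
    product-nonNeg = ℚₚ.nonNeg*nonNeg⇒nonNeg (2ℚ ℚ.* x i) {{ℚₚ.pos⇒nonNeg (2ℚ ℚ.* x i) {{2x-pos 2≤dᵢ}}}}
                       (ℕ→ℚ (d i) ℚ.- 2ℚ) {{nonNegative (p≤q⇒0≤q-p (ℕ→ℚ-mono-≤ 2≤dᵢ))}}

  excess≡0⇒d≤2 : ∀ i → excess (x i) ≡ 0ℚ → d i ≤ 2
  excess≡0⇒d≤2 i excess≡0 with d i ℕ.≤? 2
  ... | yes dᵢ≤2 = dᵢ≤2
  ... | no  dᵢ≰2 = contradiction (trans (≡.sym (excess-branch 2≤dᵢ)) excess≡0)
                                 (ℚₚ.<⇒≢ (ℚₚ.positive⁻¹ _ {{product-pos}}) ∘ ≡.sym)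
    where
    2≤dᵢ : 2 ≤ d i
    2≤dᵢ = ℕₚ.<⇒≤ (ℕₚ.≰⇒> dᵢ≰2)
    product-pos : Positive (2ℚ ℚ.* x i ℚ.* (ℕ→ℚ (d i) ℚ.- 2ℚ))
    product-pos = ℚₚ.pos*pos⇒pos (2ℚ ℚ.* x i) {{2x-pos 2≤dᵢ}}
                    (ℕ→ℚ (d i) ℚ.- 2ℚ) {{positive (p<q⇒0<q-p (ℕ→ℚ-mono-< (ℕₚ.≰⇒> dᵢ≰2)))}}

  d≤2⇒excess≡0 : ∀ i → d i ≤ 2 → excess (x i) ≡ 0ℚ
  d≤2⇒excess≡0 i dᵢ≤2 with leaf⊎branch i
  ... | inj₁ dᵢ≡1 = excess-leaf dᵢ≡1
  ... | inj₂ 2≤dᵢ = begin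
    excess (x i)                           ≡⟨ excess-branch 2≤dᵢ ⟩
    2ℚ ℚ.* x i ℚ.* (ℕ→ℚ (d i) ℚ.- 2ℚ)      ≡⟨ cong (λ k → 2ℚ ℚ.* x i ℚ.* (ℕ→ℚ k ℚ.- 2ℚ)) (ℕₚ.≤-antisym dᵢ≤2 2≤dᵢ) ⟩
    2ℚ ℚ.* x i ℚ.* 0ℚ                      ≡⟨ ℚₚ.*-zeroʳ (2ℚ ℚ.* x i) ⟩
    0ℚ                                     ∎
    where open ≡-Reasoning

  0<∣x∣ : ∀ i → 0ℚ ℚ.< ℚ.∣ x i ∣
  0<∣x∣ i with leaf⊎branch i
  ... | inj₁ dᵢ≡1 = subst (0ℚ ℚ.<_) (≡.sym (p<0⇒∣p∣≡-p (x<0 dᵢ≡1))) (ℚₚ.neg-antimono-< (x<0 dᵢ≡1))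
  ... | inj₂ 2≤dᵢ = subst (0ℚ ℚ.<_) (≡.sym (ℚₚ.0≤p⇒∣p∣≡p (ℚₚ.<⇒≤ (0<x 2≤dᵢ)))) (0<x 2≤dᵢ)

  Σx≡0 : Σℚ n x ≡ 0ℚ
  Σx≡0 = begin
    Σℚ n x
      ≡⟨ Σℚ-distrib-+ n (ℕ→ℚ ∘ d) (λ _ → ℚ.- a) ⟩
    Σℚ n (ℕ→ℚ ∘ d) ℚ.+ Σℚ n (λ _ → ℚ.- a)
      ≡⟨ cong₂ ℚ._+_ (≡.sym (ℕ→ℚ-homo-Σ n d)) (Σℚ-const n (ℚ.- a)) ⟩
    ℕ→ℚ (Σℕ n d) ℚ.+ N ℚ.* ℚ.- a
      ≡⟨ cong (ℚ._+ N ℚ.* ℚ.- a) mean ⟨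
    N ℚ.* a ℚ.+ N ℚ.* ℚ.- a
      ≡⟨ solve 2 (λ N a → N :* a :+ N :* (:- a) := con 0ℚ) refl N a ⟩
    0ℚ
      ∎
    where
    open ≡-Reasoning
    open +-*-Solver

  Σx² Σ∣x∣ : ℚ
  Σx²  = Σℚ n (λ i → x i ℚ.* x i)
  Σ∣x∣ = Σℚ n (λ i → ℚ.∣ x i ∣)

  Σexcess : Σℚ n (λ i → excess (x i)) ≡ 2ℚ ℚ.* Σx² ℚ.- Σ∣x∣
  Σexcess = begin
    Σℚ n (λ i → excess (x i))
      ≡⟨ Σℚ-distrib-+ n _ (λ i → ℚ.- (c ℚ.* x i)) ⟩
    Σℚ n (λ i → 2ℚ ℚ.* (x i ℚ.* x i) ℚ.- ℚ.∣ x i ∣) ℚ.+ Σℚ n (λ i → ℚ.- (c ℚ.* x i))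
      ≡⟨ cong₂ ℚ._+_ (Σℚ-distrib-+ n _ (λ i → ℚ.- ℚ.∣ x i ∣)) (≡.sym (neg-distrib-Σℚ n (λ i → c ℚ.* x i))) ⟩
    Σℚ n (λ i → 2ℚ ℚ.* (x i ℚ.* x i)) ℚ.+ Σℚ n (λ i → ℚ.- ℚ.∣ x i ∣) ℚ.- Σℚ n (λ i → c ℚ.* x i)
      ≡⟨ cong₂ ℚ._-_ (cong₂ ℚ._+_ (*-distribˡ-Σℚ n 2ℚ (λ i → x i ℚ.* x i)) (neg-distrib-Σℚ n (λ i → ℚ.∣ x i ∣)))
                     (*-distribˡ-Σℚ n c x) ⟨
    2ℚ ℚ.* Σx² ℚ.- Σ∣x∣ ℚ.- c ℚ.* Σℚ n x
      ≡⟨ cong (λ σ → 2ℚ ℚ.* Σx² ℚ.- Σ∣x∣ ℚ.- c ℚ.* σ) Σx≡0 ⟩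
    2ℚ ℚ.* Σx² ℚ.- Σ∣x∣ ℚ.- c ℚ.* 0ℚ
      ≡⟨ solve 3 (λ q s c → q :- s :- c :* con 0ℚ := q :- s) refl (2ℚ ℚ.* Σx²) Σ∣x∣ c ⟩
    2ℚ ℚ.* Σx² ℚ.- Σ∣x∣
      ∎
    where
    open ≡-Reasoning
    open +-*-Solver

  Σ∣x∣≤2Σx² : Σ∣x∣ ℚ.≤ 2ℚ ℚ.* Σx²
  Σ∣x∣≤2Σx² = 0≤q-p⇒p≤q (subst (0ℚ ℚ.≤_) Σexcess (Σℚ-nonNeg n 0≤excess))

  2Σx²≡Σ∣x∣⇔d≤2 : (2ℚ ℚ.* Σx² ≡ Σ∣x∣) ⇔ (∀ i → d i ≤ 2)
  2Σx²≡Σ∣x∣⇔d≤2 = mk⇔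
    (λ 2Σx²≡Σ∣x∣ i → excess≡0⇒d≤2 i (Σℚ≡0⇒≡0 n 0≤excess
       (trans Σexcess (trans (cong (ℚ._- Σ∣x∣) 2Σx²≡Σ∣x∣) (ℚₚ.+-inverseʳ Σ∣x∣))) i))
    (λ d≤2 → q-p≡0⇒q≡p (begin
       2ℚ ℚ.* Σx² ℚ.- Σ∣x∣          ≡⟨ Σexcess ⟨
       Σℚ n (λ i → excess (x i))    ≡⟨ Σℚ-cong n (λ i → d≤2⇒excess≡0 i (d≤2 i)) ⟩
       Σℚ n (λ _ → 0ℚ)              ≡⟨ Σℚ-const n 0ℚ ⟩
       N ℚ.* 0ℚ                     ≡⟨ ℚₚ.*-zeroʳ N ⟩
       0ℚ                           ∎))
    where open ≡-Reasoning

  0<Σ∣x∣ : Fin n → 0ℚ ℚ.< Σ∣x∣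
  0<Σ∣x∣ i₀ = Σℚ-pos n (λ i → ℚₚ.0≤∣p∣ (x i)) i₀ (0<∣x∣ i₀)

module Ratio (V S Q h : ℚ) .{{_ : Positive S}} .{{_ : Positive h}} (V≡2hQ : V ≡ 2ℚ ℚ.* h ℚ.* Q) where

  private
    instance
      S≢0 : NonZero S
      S≢0 = ℚₚ.pos⇒nonZero S

    V≡h*2Q : V ≡ h ℚ.* (2ℚ ℚ.* Q)
    V≡h*2Q = trans V≡2hQ (solve 2 (λ h Q → con 2ℚ :* h :* Q := h :* (con 2ℚ :* Q)) refl h Q)
      where open +-*-Solver

  h≤V÷S : S ℚ.≤ 2ℚ ℚ.* Q → h ℚ.≤ V ℚ.÷ S
  h≤V÷S S≤2Q = ℚₚ.*-cancelʳ-≤-pos S (begin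
    h ℚ.* S                 ≤⟨ ℚₚ.*-monoˡ-≤-nonNeg h {{ℚₚ.pos⇒nonNeg h}} S≤2Q ⟩
    h ℚ.* (2ℚ ℚ.* Q)        ≡⟨ V≡h*2Q ⟨
    V                       ≡⟨ ÷-*-cancel V S ⟨
    V ℚ.÷ S ℚ.* S           ∎)
    where open ℚₚ.≤-Reasoning

  V÷S≡h⇔2Q≡S : (V ℚ.÷ S ≡ h) ⇔ (2ℚ ℚ.* Q ≡ S)
  V÷S≡h⇔2Q≡S = mk⇔
    (λ V÷S≡h → *-cancelʳ-≡-pos h (trans (ℚₚ.*-comm (2ℚ ℚ.* Q) h) (begin
      h ℚ.* (2ℚ ℚ.* Q)      ≡⟨ V≡h*2Q ⟨
      V                     ≡⟨ ÷-*-cancel V S ⟨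
      V ℚ.÷ S ℚ.* S         ≡⟨ cong (ℚ._* S) V÷S≡h ⟩
      h ℚ.* S               ≡⟨ ℚₚ.*-comm h S ⟩
      S ℚ.* h               ∎)))
    (λ 2Q≡S → *-cancelʳ-≡-pos S (begin
      V ℚ.÷ S ℚ.* S         ≡⟨ ÷-*-cancel V S ⟩
      V                     ≡⟨ V≡h*2Q ⟩
      h ℚ.* (2ℚ ℚ.* Q)      ≡⟨ cong (h ℚ.*_) 2Q≡S ⟩
      h ℚ.* S               ∎))
    where open ≡-Reasoning

corollary25 : (n : ℕ) → 4 ≤ n → (T : Graph n) → IsTree T →
    Σ (NonZero (S T)) λ nz →
      (inv (2 * n) ≤ℚ Ω T {{nz}}) × ((Ω T {{nz}} ≡ inv (2 * n)) ⇔ (T ≅ Pathₙ n))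
corollary25 n 4≤n T tree with ℕₚ.m≤n⇒∃[o]m+o≡n 4≤n
... | k , refl =
  ℚₚ.pos⇒nonZero (S T) , Ratio.h≤V÷S (Var T) (S T) Σx² h Var≡2hΣx² Σ∣x∣≤2Σx²
  , ⇔-trans (Ratio.V÷S≡h⇔2Q≡S (Var T) (S T) Σx² h Var≡2hΣx²)
            (⇔-trans 2Σx²≡Σ∣x∣⇔d≤2 (tree⇒deg≤2⇔≅Pathₙ T tree))
  where
  connected : Connected T
  connected = proj₁ tree
  1≤deg : ∀ i → 1 ≤ deg T i
  1≤deg = connected⇒1≤deg T connected
  branch : ∃ λ i → 2 ≤ deg T i
  branch = connected⇒∃2≤deg T connected
  open DegreeDeviation (deg T) 1≤deg (n<degreeSum T 1≤deg (proj₂ branch))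
                       (tree⇒degreeSum<2n T connected (proj₂ tree)) (avgDeg T) (avgDeg-mean T)
  h : ℚ
  h = inv (2 * (4 + k))
  instance
    S-pos : Positive (S T)
    S-pos = positive (0<Σ∣x∣ Fin.zero)
    h-pos : Positive h
    h-pos = ℚₚ.normalize-pos 1 (2 * (4 + k))
  Var≡2hΣx² : Var T ≡ 2ℚ ℚ.* h ℚ.* Σx²
  Var≡2hΣx² = cong (ℚ._* Σx²) (inv≡2*inv[2*] (3 + k))
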